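{- For integers $n$ and $k$ with $1\leq k\leq \lfloor n/2\rfloor$, $$S_{2k-1}(2,1;n+1)+S_{2k-1}(2,1;n)=HM_{n+1,k}-HM_{n,k}.$$
   Context: $S_k(2,1;n)$ is the number of standard Young tableaux whose shape is a partition $\lambda$ of $n$ with $\lambda_3\leq 1$ (i.e. $\lambda=(\lambda_1,\lambda_2,1,\dots,1)$) and $\lambda_1-\lambda_2=k$. A Motzkin path of order $n$ is a lattice path from $(0,0)$ to $(n,0)$ using steps $(1,1)$, $(1,-1)$, $(1,0)$ that never goes below the $x$-axis. A hump is a consecutive sequence of steps of a Motzkin path consisting of an up step, followed by zero or more flat steps, followed by a down step; its height is the $y$-coordinate reached by its up step. $HM_{n,k}$ is the number of pairs $(M,P)$ with $M$ a Motzkin path of order $n$ and $P$ a hump of $M$ of height $k$. -}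

module Defs where

open import Data.Nat using (ℕ; zero; suc; _+_; _∸_; _<ᵇ_; _≡ᵇ_; _≤ᵇ_)
open import Data.Bool using (Bool; true; false; _∧_; _∨_; not; if_then_else_)
open import Data.List using (List; []; _∷_; map; concatMap; filter; length; concat; upTo; foldr)
open import Data.Nat.ListAction using (sum)
open import Function using (_∘_)
open import Relation.Nullary.Decidable using (Dec; yes; no)
open import Data.Bool using (T)
open import Data.Bool.Properties using (T?)

countᵇ : {A : Set} → (A → Bool) → List A → ℕ
countᵇ p []       = 0
countᵇ p (x ∷ xs) = (if p x then 1 else 0) + countᵇ p xs

allᵇ : {A : Set} → (A → Bool) → List A → Bool
allᵇ p = foldr (λ x b → p x ∧ b) true

range1 : ℕ → List ℕ
range1 n = map suc (upTo n)

wordsOver : ℕ → ℕ → List (List ℕ)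
wordsOver n zero    = [] ∷ []
wordsOver n (suc L) = concatMap (λ a → map (a ∷_) (wordsOver n L)) (range1 n)

nonIncreasing : List ℕ → Bool
nonIncreasing []           = true
nonIncreasing (x ∷ [])     = true
nonIncreasing (x ∷ y ∷ xs) = (y ≤ᵇ x) ∧ nonIncreasing (y ∷ xs)

-- all partitions of n: non-increasing lists of positive integers summing to n
-- (every part is ≥ 1 and ≤ n, and there are at most n parts)
partitions : ℕ → List (List ℕ)
partitions n =
  filter (λ l → T? (nonIncreasing l ∧ (sum l ≡ᵇ n)))
         (concatMap (wordsOver n) (0 ∷ range1 n))

-- i-th part (1-indexed), 0 if absent
part : List ℕ → ℕ → ℕ
part []       _             = 0
part (x ∷ xs) zero          = 0
part (x ∷ xs) (suc zero)    = x
part (x ∷ xs) (suc (suc i)) = part xs (suc i)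

-- Standard Young tableaux
-- A filling of shape λ = (λ₁,…,λ_ℓ) is a list of rows, row i having λ_i
-- entries (English notation).

Filling : Set
Filling = List (List ℕ)

fillings : ℕ → List ℕ → List Filling
fillings n []       = [] ∷ []
fillings n (r ∷ μ') = concatMap (λ row → map (row ∷_) (fillings n μ')) (wordsOver n r)

strictlyIncreasing : List ℕ → Bool
strictlyIncreasing []           = true
strictlyIncreasing (x ∷ [])     = true
strictlyIncreasing (x ∷ y ∷ xs) = (x <ᵇ y) ∧ strictlyIncreasing (y ∷ xs)

-- entrywise strict increase from an upper row to the row just below it
-- (compares the positions present in the lower row)
belowOK : List ℕ → List ℕ → Bool
belowOK _        []       = true
belowOK []       (_ ∷ _)  = false
belowOK (x ∷ xs) (y ∷ ys) = (x <ᵇ y) ∧ belowOK xs ys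

columnsOK : Filling → Bool
columnsOK []             = true
columnsOK (r ∷ [])       = true
columnsOK (r ∷ s ∷ rows) = belowOK r s ∧ columnsOK (s ∷ rows)

occurrences : ℕ → List ℕ → ℕ
occurrences j = countᵇ (j ≡ᵇ_)

isSYT : ℕ → Filling → Bool
isSYT n T =
  allᵇ (λ j → occurrences j (concat T) ≡ᵇ 1) (range1 n)
  ∧ allᵇ strictlyIncreasing T
  ∧ columnsOK T

numSYT : ℕ → List ℕ → ℕ
numSYT n μ = countᵇ (isSYT n) (fillings n μ)

S21 : ℕ → ℕ → ℕ
S21 k n =
  sum (map (numSYT n)
           (filter (λ μ' → T? ((part μ' 3 ≤ᵇ 1) ∧ ((part μ' 1 ∸ part μ' 2) ≡ᵇ k)))
                   (partitions n)))

data Step : Set where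
  U D F : Step

allSteps : List Step
allSteps = U ∷ D ∷ F ∷ []

stepWords : ℕ → List (List Step)
stepWords zero    = [] ∷ []
stepWords (suc n) = concatMap (λ s → map (s ∷_) (stepWords n)) allSteps

motzkinFrom : ℕ → List Step → Bool
motzkinFrom h       []       = h ≡ᵇ 0
motzkinFrom h       (U ∷ xs) = motzkinFrom (suc h) xs
motzkinFrom zero    (D ∷ xs) = false
motzkinFrom (suc h) (D ∷ xs) = motzkinFrom h xs
motzkinFrom h       (F ∷ xs) = motzkinFrom h xs

isMotzkin : List Step → Bool
isMotzkin = motzkinFrom 0

motzkinPaths : ℕ → List (List Step)
motzkinPaths n = filter (T? ∘ isMotzkin) (stepWords n)

flatsThenDown : List Step → Bool
flatsThenDown []       = false
flatsThenDown (D ∷ _)  = true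
flatsThenDown (F ∷ xs) = flatsThenDown xs
flatsThenDown (U ∷ _)  = false

-- A hump is determined by its initial up step: it is an up step followed
-- by zero or more flat steps and then a down step; its height is the
-- y-coordinate reached by the up step, i.e. h + 1.
humpsFrom : ℕ → ℕ → List Step → ℕ
humpsFrom k h []       = 0
humpsFrom k h (U ∷ xs) =
  (if flatsThenDown xs ∧ (suc h ≡ᵇ k) then 1 else 0) + humpsFrom k (suc h) xs
humpsFrom k h (D ∷ xs) = humpsFrom k (h ∸ 1) xs
humpsFrom k h (F ∷ xs) = humpsFrom k h xs

humps : ℕ → List Step → ℕ
humps k = humpsFrom k 0

HM : ℕ → ℕ → ℕ
HM n k = sum (map (humps k) (motzkinPaths n))

-- Both sides count paths of up (U), down (D) and flat (F) steps that never go below the axis;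
-- let P_n(a, b) be the number of such paths of length n from height a to height b.
--
-- Reading the entries 1, …, n of a standard Young tableau of shape (λ₁, λ₂, 1, …, 1) in increasing
-- order and writing U for an entry of the first row, D for one of the second row and F for one
-- further down the first column is a bijection onto the paths from height 0 to height K = λ₁ − λ₂
-- that take no flat step before their first down step. Sorting paths by their first step other
-- than U, and trading that step between D and F, gives
-- S_K(2,1;n+1) + S_K(2,1;n) = P_n(0, K) + [n + 1 = K].
--
-- A hump of height k = t + 1 cuts its Motzkin path into a path from 0 to t, the hump U F⋯F D, and
-- a path from t back to 0. The first-step recurrence for the number of such pairs is solved by a
-- convolution (Duhamel's principle), whose increment HM_{n+1,k} − HM_{n,k} equals
-- Σ_{i+j=n−1} P_i(0, t) P_j(t, 0) = P_n(2t + 1, 0): cut a path from height 2t + 1 where it first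
-- reaches height t. Path reversal gives P_n(0, K) = P_n(K, 0), and n ≥ 2k kills the indicator,
-- so K = 2k − 1 yields the identity.

module Submission where

open import Data.Bool using (Bool; true; false; if_then_else_; T; _∧_)
open import Data.Bool.Properties using (T?; T-∧; ∧-zeroʳ; ∧-identityʳ)
open import Data.Empty using (⊥-elim)
import Data.List as List
open import Data.List
  using (List; []; _∷_; [_]; _∷ʳ_; map; filter; length; concat; concatMap; _++_; take; cartesianProductWith)
open import Data.List.Properties
  using (map-++; map-∘; map-cong; map-id-local; length-map; ∷-injective; ∷ʳ-++; length-++; concat-map-[_])
open import Data.List.Membership.Propositional using (_∈_; lose; find)
open import Data.List.Membership.Propositional.Properties
  using (∈-filter⁻; ∈-filter⁺; ∈-map⁻; ∈-map⁺; ∈-upTo⁺; ∈-upTo⁻; ∈-concatMap⁺; ∈-concatMap⁻;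
         ∈-cartesianProductWith⁺; ∈-cartesianProductWith⁻)
open import Data.List.Membership.Propositional.Properties.WithK using (unique∧set⇒bag)
open import Data.List.Relation.Binary.BagAndSetEquality using (_∼[_]_; set; ∼bag⇒↭)
open import Data.List.Relation.Binary.Permutation.Propositional.Properties using (↭-length)
open import Data.List.Relation.Unary.All as All using (All; []; _∷_)
import Data.List.Relation.Unary.All.Properties as All
open import Data.List.Relation.Unary.AllPairs as AllPairs using ([]; _∷_)
import Data.List.Relation.Unary.AllPairs.Properties as AllPairs
open import Data.List.Relation.Unary.Any using (here; there)
open import Data.List.Relation.Unary.Unique.Propositional using (Unique)
import Data.List.Relation.Unary.Unique.Propositional.Properties as Unique
open import Data.Nat using (ℕ; zero; suc; _+_; _∸_; _*_; _≤_; _<_; _/_; _≡ᵇ_; _<ᵇ_; _≤ᵇ_; z≤n; s≤s; z<s)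
open import Data.Nat.DivMod using (m/n*n≤m)
open import Data.Nat.ListAction using (sum)
open import Data.Nat.ListAction.Properties using (sum-++)
open import Data.Nat.Properties
open import Algebra.Properties.CommutativeSemigroup +-commutativeSemigroup using (interchange)
open import Data.Nat.Tactic.RingSolver using (solve-∀)
open import Data.Product using (_×_; _,_; proj₁; proj₂; ∃-syntax)
open import Data.Sum using (_⊎_; inj₁; inj₂)
open import Function using (_∘_; mk⇔; Equivalence)
open import Relation.Binary.PropositionalEquality hiding ([_])
open import Relation.Nullary using (¬_)
open ≡-Reasoning

open import Defs

𝟙 : Bool → ℕ
𝟙 b = if b then 1 else 0

∧⁺ : ∀ {a b} → T a → T b → T (a ∧ b)
∧⁺ p q = Equivalence.from T-∧ (p , q)

∧⁻ : ∀ {a b} → T (a ∧ b) → T a × T b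
∧⁻ = Equivalence.to T-∧

allᵇ⁺ : ∀ {A : Set} {p : A → Bool} {xs} → All (T ∘ p) xs → T (allᵇ p xs)
allᵇ⁺ []         = _
allᵇ⁺ (px ∷ pxs) = ∧⁺ px (allᵇ⁺ pxs)

allᵇ⁻ : ∀ {A : Set} {p : A → Bool} xs → T (allᵇ p xs) → All (T ∘ p) xs
allᵇ⁻ []       _ = []
allᵇ⁻ (x ∷ xs) t = proj₁ (∧⁻ t) ∷ allᵇ⁻ xs (proj₂ (∧⁻ t))

≡ᵇ-refl : ∀ j → (j ≡ᵇ j) ≡ true
≡ᵇ-refl zero    = refl
≡ᵇ-refl (suc j) = ≡ᵇ-refl j

≡ᵇ-false : ∀ {j x} → j ≢ x → (j ≡ᵇ x) ≡ false
≡ᵇ-false {j} {x} j≢x with j ≡ᵇ x in eq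
... | false = refl
... | true  = ⊥-elim (j≢x (≡ᵇ⇒≡ j x (subst T (sym eq) _)))

≡ᵇ-comm : ∀ a b → (a ≡ᵇ b) ≡ (b ≡ᵇ a)
≡ᵇ-comm zero    zero    = refl
≡ᵇ-comm zero    (suc b) = refl
≡ᵇ-comm (suc a) zero    = refl
≡ᵇ-comm (suc a) (suc b) = ≡ᵇ-comm a b

countᵇ-++ : ∀ {A : Set} (p : A → Bool) xs ys → countᵇ p (xs ++ ys) ≡ countᵇ p xs + countᵇ p ys
countᵇ-++ p []       ys = refl
countᵇ-++ p (x ∷ xs) ys = trans (cong (𝟙 (p x) +_) (countᵇ-++ p xs ys)) (sym (+-assoc (𝟙 (p x)) _ _))

countᵇ-concatMap : ∀ {A B : Set} (p : B → Bool) (f : A → List B) xs →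
                   countᵇ p (concatMap f xs) ≡ sum (map (countᵇ p ∘ f) xs)
countᵇ-concatMap p f []       = refl
countᵇ-concatMap p f (x ∷ xs) =
  trans (countᵇ-++ p (f x) (concatMap f xs)) (cong (countᵇ p (f x) +_) (countᵇ-concatMap p f xs))

countᵇ≡sum-𝟙 : ∀ {A : Set} (p : A → Bool) xs → countᵇ p xs ≡ sum (map (𝟙 ∘ p) xs)
countᵇ≡sum-𝟙 p []       = refl
countᵇ≡sum-𝟙 p (x ∷ xs) = cong (𝟙 (p x) +_) (countᵇ≡sum-𝟙 p xs)

countᵇ≡length-filter : ∀ {A : Set} (p : A → Bool) xs → countᵇ p xs ≡ length (filter (T? ∘ p) xs)
countᵇ≡length-filter p [] = refl
countᵇ≡length-filter p (x ∷ xs) with p x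
... | true  = cong suc (countᵇ≡length-filter p xs)
... | false = countᵇ≡length-filter p xs

countᵇ-bijection : ∀ {A B : Set} (p : A → Bool) (q : B → Bool) {xs ys} →
  Unique xs → Unique ys → (φ : A → B) (ψ : B → A) →
  (∀ {x} → x ∈ xs → T (p x) → φ x ∈ ys × T (q (φ x)) × ψ (φ x) ≡ x) →
  (∀ {y} → y ∈ ys → T (q y) → ψ y ∈ xs × T (p (ψ y)) × φ (ψ y) ≡ y) →
  countᵇ p xs ≡ countᵇ q ys
countᵇ-bijection {A} {B} p q {xs} {ys} xs! ys! φ ψ to from = begin
  countᵇ p xs                 ≡⟨ countᵇ≡length-filter p xs ⟩
  length sel                  ≡⟨ length-map φ sel ⟨
  length (map φ sel)          ≡⟨ ↭-length (∼bag⇒↭ (unique∧set⇒bag φsel! (Unique.filter⁺ (T? ∘ q) ys!) same)) ⟩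
  length (filter (T? ∘ q) ys) ≡⟨ countᵇ≡length-filter q ys ⟨
  countᵇ q ys                 ∎
  where
  sel : List A
  sel = filter (T? ∘ p) xs
  to′ : ∀ {x} → x ∈ sel → φ x ∈ ys × T (q (φ x)) × ψ (φ x) ≡ x
  to′ x∈ = let x∈xs , px = ∈-filter⁻ (T? ∘ p) x∈ in to x∈xs px
  -- ψ undoes φ on the selected elements, so their images stay duplicate-free
  φsel! : Unique (map φ sel)
  φsel! = Unique.map⁻ (subst Unique (sym ψφsel) (Unique.filter⁺ (T? ∘ p) xs!))
    where
    ψφsel : map ψ (map φ sel) ≡ sel
    ψφsel = trans (sym (map-∘ sel)) (map-id-local (All.tabulate (proj₂ ∘ proj₂ ∘ to′)))
  same : map φ sel ∼[ set ] filter (T? ∘ q) ys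
  same {z} = mk⇔ forth back
    where
    forth : z ∈ map φ sel → z ∈ filter (T? ∘ q) ys
    forth z∈ with ∈-map⁻ φ z∈
    ... | x , x∈ , refl = let φx∈ , qφx , _ = to′ x∈ in ∈-filter⁺ (T? ∘ q) φx∈ qφx
    back : z ∈ filter (T? ∘ q) ys → z ∈ map φ sel
    back z∈ with ∈-filter⁻ (T? ∘ q) z∈
    ... | z∈ys , qz with from z∈ys qz
    ... | ψz∈ , pψz , φψz = subst (_∈ map φ sel) φψz (∈-map⁺ φ (∈-filter⁺ (T? ∘ p) ψz∈ pψz))

occurrences-head : ∀ j l → occurrences j (j ∷ l) ≡ suc (occurrences j l)
occurrences-head j l rewrite ≡ᵇ-refl j = refl

occurrences-skip : ∀ {j x} l → j ≢ x → occurrences j (x ∷ l) ≡ occurrences j l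
occurrences-skip l j≢x rewrite ≡ᵇ-false j≢x = refl

occurrences-below : ∀ {j} l → All (j <_) l → occurrences j l ≡ 0
occurrences-below []      []           = refl
occurrences-below (x ∷ l) (j<x ∷ j<l) = trans (occurrences-skip l (<⇒≢ j<x)) (occurrences-below l j<l)

sum-map-++ : ∀ {A : Set} (f : A → ℕ) xs ys → sum (map f (xs ++ ys)) ≡ sum (map f xs) + sum (map f ys)
sum-map-++ f xs ys = trans (cong sum (map-++ f xs ys)) (sum-++ (map f xs) (map f ys))

sum-map-cong : ∀ {A : Set} {f g : A → ℕ} → (∀ x → f x ≡ g x) → ∀ xs → sum (map f xs) ≡ sum (map g xs)
sum-map-cong e xs = cong sum (map-cong e xs)

sum-map-zero : ∀ {A : Set} {f : A → ℕ} → (∀ x → f x ≡ 0) → ∀ xs → sum (map f xs) ≡ 0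
sum-map-zero e []       = refl
sum-map-zero e (x ∷ xs) = cong₂ _+_ (e x) (sum-map-zero e xs)

sum-map-+ : ∀ {A : Set} (f g : A → ℕ) xs → sum (map (λ x → f x + g x) xs) ≡ sum (map f xs) + sum (map g xs)
sum-map-+ f g []       = refl
sum-map-+ f g (x ∷ xs) = trans (cong (f x + g x +_) (sum-map-+ f g xs)) (interchange (f x) (g x) _ _)

sum-map-*ˡ : ∀ {A : Set} c (f : A → ℕ) xs → sum (map (λ x → c * f x) xs) ≡ c * sum (map f xs)
sum-map-*ˡ c f []       = sym (*-zeroʳ c)
sum-map-*ˡ c f (x ∷ xs) = trans (cong (c * f x +_) (sum-map-*ˡ c f xs)) (sym (*-distribˡ-+ c (f x) _))

sum-map-filter : ∀ {A : Set} (p : A → Bool) (f : A → ℕ) xs →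
                 sum (map f (filter (T? ∘ p) xs)) ≡ sum (map (λ x → if p x then f x else 0) xs)
sum-map-filter p f [] = refl
sum-map-filter p f (x ∷ xs) with p x
... | true  = cong (f x +_) (sum-map-filter p f xs)
... | false = sum-map-filter p f xs

module _ {A : Set} where

  concatMap-prefix≡cartesianProduct : ∀ (xs : List A) (ys : List (List A)) →
    concatMap (λ a → map (a ∷_) ys) xs ≡ cartesianProductWith List._∷_ xs ys
  concatMap-prefix≡cartesianProduct []       ys = refl
  concatMap-prefix≡cartesianProduct (x ∷ xs) ys =
    cong (map (x ∷_) ys ++_) (concatMap-prefix≡cartesianProduct xs ys)

  Unique-prefixes : ∀ {xs : List A} {ys : List (List A)} → Unique xs → Unique ys →
                    Unique (concatMap (λ a → map (a ∷_) ys) xs)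
  Unique-prefixes {xs} {ys} xs! ys! = subst Unique (sym (concatMap-prefix≡cartesianProduct xs ys))
    (Unique.cartesianProductWith⁺ List._∷_ ∷-injective xs! ys!)

  ∈-prefixes⁺ : ∀ {xs : List A} {ys : List (List A)} {a w} → a ∈ xs → w ∈ ys →
                a ∷ w ∈ concatMap (λ a → map (a ∷_) ys) xs
  ∈-prefixes⁺ {xs} {ys} a∈ w∈ = subst (_ ∈_) (sym (concatMap-prefix≡cartesianProduct xs ys))
    (∈-cartesianProductWith⁺ List._∷_ a∈ w∈)

  ∈-prefixes⁻ : ∀ (xs : List A) (ys : List (List A)) {v} → v ∈ concatMap (λ a → map (a ∷_) ys) xs →
                ∃[ a ] ∃[ w ] a ∈ xs × w ∈ ys × v ≡ a ∷ w
  ∈-prefixes⁻ xs ys v∈ = ∈-cartesianProductWith⁻ List._∷_ xs ys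
    (subst (_ ∈_) (concatMap-prefix≡cartesianProduct xs ys) v∈)

module _ {A B : Set} where

  Unique-concatMap : ∀ (f : A → List B) (tag : B → A) {xs} → (∀ {x z} → z ∈ f x → tag z ≡ x) →
                     (∀ x → Unique (f x)) → Unique xs → Unique (concatMap f xs)
  Unique-concatMap f tag tagged f! xs! = Unique.concat⁺ (All.map⁺ (All.universal f! _))
    (AllPairs.map⁺ (AllPairs.map (λ x≢y {_} (z∈fx , z∈fy) → x≢y (trans (sym (tagged z∈fx)) (tagged z∈fy)))
                                  xs!))

module WordsOf {A : Set} (alphabet : List A) (words : ℕ → List (List A))
               (words-zero : words 0 ≡ [] ∷ [])
               (words-suc : ∀ L → words (suc L) ≡ concatMap (λ a → map (a ∷_) (words L)) alphabet) where

  Unique-words : Unique alphabet → ∀ L → Unique (words L)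
  Unique-words alphabet! zero    = subst Unique (sym words-zero) ([] ∷ [])
  Unique-words alphabet! (suc L) =
    subst Unique (sym (words-suc L)) (Unique-prefixes alphabet! (Unique-words alphabet! L))

  ∈-words⁺ : ∀ {w} → All (_∈ alphabet) w → w ∈ words (length w)
  ∈-words⁺ []                = subst ([] ∈_) (sym words-zero) (here refl)
  ∈-words⁺ {a ∷ w} (a∈ ∷ w∈) = subst (_ ∈_) (sym (words-suc (length w))) (∈-prefixes⁺ a∈ (∈-words⁺ w∈))

  ∈-words⁻ : ∀ L {w} → w ∈ words L → length w ≡ L × All (_∈ alphabet) w
  ∈-words⁻ zero    w∈ with subst (_ ∈_) words-zero w∈
  ... | here refl = refl , []
  ∈-words⁻ (suc L) w∈ with ∈-prefixes⁻ alphabet (words L) (subst (_ ∈_) (words-suc L) w∈)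
  ... | a , w , a∈ , w∈ , refl = let |w| , all = ∈-words⁻ L w∈ in cong suc |w| , a∈ ∷ all

Within : ℕ → ℕ → ℕ → Set
Within i n x = i ≤ x × x < i + n

∈-range1⁺ : ∀ {n x} → Within 1 n x → x ∈ range1 n
∈-range1⁺ {x = suc x} (s≤s _ , s≤s x<n) = ∈-map⁺ suc (∈-upTo⁺ x<n)

∈-range1⁻ : ∀ {n x} → x ∈ range1 n → Within 1 n x
∈-range1⁻ x∈ with ∈-map⁻ suc x∈
... | i , i∈ , refl = s≤s z≤n , s≤s (∈-upTo⁻ i∈)

Unique-range1 : ∀ n → Unique (range1 n)
Unique-range1 n = Unique.map⁺ suc-injective (Unique.upTo⁺ n)

∈-allSteps : ∀ s → s ∈ allSteps
∈-allSteps U = here refl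
∈-allSteps D = there (here refl)
∈-allSteps F = there (there (here refl))

Unique-allSteps : Unique allSteps
Unique-allSteps = ((λ ()) ∷ (λ ()) ∷ []) ∷ ((λ ()) ∷ []) ∷ [] ∷ []

open WordsOf allSteps stepWords refl (λ _ → refl) public
  renaming (Unique-words to Unique-stepWords; ∈-words⁺ to ∈-stepWords⁺; ∈-words⁻ to ∈-stepWords⁻)

module _ (n : ℕ) where
  open WordsOf (range1 n) (wordsOver n) refl (λ _ → refl) public
    renaming (Unique-words to Unique-wordsOver; ∈-words⁺ to ∈-wordsOver⁺; ∈-words⁻ to ∈-wordsOver⁻)

Unique-fillings : ∀ n μ → Unique (fillings n μ)
Unique-fillings n []      = [] ∷ []
Unique-fillings n (r ∷ μ) = Unique-prefixes (Unique-wordsOver n (Unique-range1 n) r) (Unique-fillings n μ)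

∈-fillings⁺ : ∀ n {T} → All (All (_∈ range1 n)) T → T ∈ fillings n (map length T)
∈-fillings⁺ n []         = here refl
∈-fillings⁺ n (r∈ ∷ T∈) = ∈-prefixes⁺ (∈-wordsOver⁺ n r∈) (∈-fillings⁺ n T∈)

∈-fillings⁻ : ∀ n μ {T} → T ∈ fillings n μ → map length T ≡ μ × All (All (_∈ range1 n)) T
∈-fillings⁻ n []      (here refl) = refl , []
∈-fillings⁻ n (r ∷ μ) T∈ with ∈-prefixes⁻ (wordsOver n r) (fillings n μ) T∈
... | row , T , row∈ , T∈ , refl =
  let |row| , row-range = ∈-wordsOver⁻ n r row∈ ; shape , T-range = ∈-fillings⁻ n μ T∈
  in cong₂ _∷_ |row| shape , row-range ∷ T-range

Unique-partitions : ∀ n → Unique (partitions n)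
Unique-partitions n = Unique.filter⁺ (λ l → T? (nonIncreasing l ∧ (sum l ≡ᵇ n)))
  (Unique-concatMap (wordsOver n) length (λ {L} w∈ → proj₁ (∈-wordsOver⁻ n L w∈))
                    (Unique-wordsOver n (Unique-range1 n)) lengths!)
  where
  lengths! : Unique (0 ∷ range1 n)
  lengths! = All.tabulate (λ x∈ → <⇒≢ (proj₁ (∈-range1⁻ x∈))) ∷ Unique-range1 n

length≤sum : ∀ {ms} → All (1 ≤_) ms → length ms ≤ sum ms
length≤sum []         = z≤n
length≤sum (1≤m ∷ ms) = +-mono-≤ 1≤m (length≤sum ms)

∈-partitions⁺ : ∀ n {μ} → All (_∈ range1 n) μ → T (nonIncreasing μ) → sum μ ≡ n → μ ∈ partitions n
∈-partitions⁺ n {μ} μ-range ni Σμ =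
  ∈-filter⁺ (λ l → T? (nonIncreasing l ∧ (sum l ≡ᵇ n)))
            (∈-concatMap⁺ (wordsOver n) (lose |μ|∈ (∈-wordsOver⁺ n μ-range))) (∧⁺ ni (≡⇒≡ᵇ _ _ Σμ))
  where
  |μ|≤n : length μ ≤ n
  |μ|≤n = subst (length μ ≤_) Σμ (length≤sum (All.map (proj₁ ∘ ∈-range1⁻) μ-range))
  |μ|∈ : length μ ∈ 0 ∷ range1 n
  |μ|∈ with length μ | |μ|≤n
  ... | zero  | _   = here refl
  ... | suc l | l<n = there (∈-range1⁺ (s≤s z≤n , s≤s l<n))

∈-partitions⁻ : ∀ n {μ} → μ ∈ partitions n → All (_∈ range1 n) μ × T (nonIncreasing μ) × sum μ ≡ n
∈-partitions⁻ n μ∈ with ∈-filter⁻ (λ l → T? (nonIncreasing l ∧ (sum l ≡ᵇ n))) μ∈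
... | μ∈words , cond with find (∈-concatMap⁻ (wordsOver n) {xs = 0 ∷ range1 n} μ∈words)
... | L , _ , μ∈wordsOver = let ni , Σμ = ∧⁻ cond in
  proj₂ (∈-wordsOver⁻ n L μ∈wordsOver) , ni , ≡ᵇ⇒≡ _ n Σμ

-- Paths

below : (ℕ → ℕ) → ℕ → ℕ
below g zero    = 0
below g (suc h) = g h

-- sum of g over the heights one up, down or flat step away from h, never below the axis
move : (ℕ → ℕ) → ℕ → ℕ
move g h = g (suc h) + below g h + g h

below-cong : ∀ {g g'} → (∀ x → g x ≡ g' x) → ∀ h → below g h ≡ below g' h
below-cong e zero    = refl
below-cong e (suc h) = e h

move-cong : ∀ {g g'} → (∀ x → g x ≡ g' x) → ∀ h → move g h ≡ move g' h
move-cong e h = cong₂ _+_ (cong₂ _+_ (e (suc h)) (below-cong e h)) (e h)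

sum3x3-transpose : ∀ a b c d e f g h i →
  (a + b + c) + (d + e + f) + (g + h + i) ≡ (a + d + g) + (b + e + h) + (c + f + i)
sum3x3-transpose = solve-∀

below-+₃ : ∀ f g k h → below f h + below g h + below k h ≡ below (λ y → f y + g y + k y) h
below-+₃ f g k zero    = refl
below-+₃ f g k (suc h) = refl

move-+₃ : ∀ f g k h → move f h + move g h + move k h ≡ move (λ y → f y + g y + k y) h
move-+₃ f g k h =
  trans (sum3x3-transpose (f (suc h)) (below f h) (f h) (g (suc h)) (below g h) (g h)
                          (k (suc h)) (below k h) (k h))
        (cong (λ z → f (suc h) + g (suc h) + k (suc h) + z + (f h + g h + k h)) (below-+₃ f g k h))

below-move-comm : ∀ (g : ℕ → ℕ → ℕ) a b →
                  below (λ x → move (g x) b) a ≡ move (λ y → below (λ x → g x y) a) b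
below-move-comm g zero    zero    = refl
below-move-comm g zero    (suc b) = refl
below-move-comm g (suc a) b       = refl

-- the first-step and the last-step decompositions of a path commute
move-comm : ∀ (g : ℕ → ℕ → ℕ) a b →
            move (λ x → move (g x) b) a ≡ move (λ y → move (λ x → g x y) a) b
move-comm g a b = begin
  move (g (suc a)) b + below (λ x → move (g x) b) a + move (g a) b
    ≡⟨ cong (λ z → move (g (suc a)) b + z + move (g a) b) (below-move-comm g a b) ⟩
  move (g (suc a)) b + move (λ y → below (λ x → g x y) a) b + move (g a) b
    ≡⟨ move-+₃ (g (suc a)) (λ y → below (λ x → g x y) a) (g a) b ⟩
  move (λ y → move (λ x → g x y) a) b ∎

𝟙-up≡below : ∀ a b → 𝟙 (suc a ≡ᵇ b) ≡ below (λ y → 𝟙 (a ≡ᵇ y)) b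
𝟙-up≡below a zero    = refl
𝟙-up≡below a (suc b) = refl

below≡𝟙-up : ∀ a b → below (λ x → 𝟙 (x ≡ᵇ b)) a ≡ 𝟙 (a ≡ᵇ suc b)
below≡𝟙-up zero    b = refl
below≡𝟙-up (suc a) b = refl

-- paths m a b: paths with m steps from height a to height b that never go below the axis
paths : ℕ → ℕ → ℕ → ℕ
paths zero    a b = 𝟙 (a ≡ᵇ b)
paths (suc m) a b = move (λ x → paths m x b) a

paths-last-step : ∀ m a b → paths (suc m) a b ≡ move (paths m a) b
paths-last-step zero a b = cong (_+ 𝟙 (a ≡ᵇ b)) (begin
  𝟙 (suc a ≡ᵇ b) + below (λ x → 𝟙 (x ≡ᵇ b)) a
    ≡⟨ +-comm (𝟙 (suc a ≡ᵇ b)) _ ⟩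
  below (λ x → 𝟙 (x ≡ᵇ b)) a + 𝟙 (suc a ≡ᵇ b)
    ≡⟨ cong₂ _+_ (below≡𝟙-up a b) (𝟙-up≡below a b) ⟩
  𝟙 (a ≡ᵇ suc b) + below (λ y → 𝟙 (a ≡ᵇ y)) b ∎)
paths-last-step (suc m) a b = begin
  move (λ x → paths (suc m) x b) a       ≡⟨ move-cong (λ x → paths-last-step m x b) a ⟩
  move (λ x → move (paths m x) b) a      ≡⟨ move-comm (paths m) a b ⟩
  move (λ y → paths (suc m) a y) b       ∎

paths-sym : ∀ m a b → paths m a b ≡ paths m b a
paths-sym zero    a b = cong 𝟙 (≡ᵇ-comm a b)
paths-sym (suc m) a b = begin
  move (λ x → paths m x b) a  ≡⟨ move-cong (λ x → paths-sym m x b) a ⟩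
  move (paths m b) a          ≡⟨ paths-last-step m b a ⟨
  paths (suc m) b a           ∎

-- Convolution

conv : (ℕ → ℕ) → (ℕ → ℕ) → ℕ → ℕ
conv f g zero    = f 0 * g 0
conv f g (suc m) = f 0 * g (suc m) + conv (λ i → f (suc i)) g m

conv-congˡ : ∀ {f f'} g → (∀ i → f i ≡ f' i) → ∀ m → conv f g m ≡ conv f' g m
conv-congˡ g e zero    = cong (_* g 0) (e 0)
conv-congˡ g e (suc m) = cong₂ _+_ (cong (_* g (suc m)) (e 0)) (conv-congˡ g (λ i → e (suc i)) m)

conv-zeroˡ : ∀ {f} g → (∀ i → f i ≡ 0) → ∀ m → conv f g m ≡ 0
conv-zeroˡ g e m = trans (conv-congˡ g e m) (zeros m)
  where
  zeros : ∀ m → conv (λ _ → 0) g m ≡ 0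
  zeros zero    = refl
  zeros (suc m) = zeros m

conv-+ˡ : ∀ f f' g m → conv (λ i → f i + f' i) g m ≡ conv f g m + conv f' g m
conv-+ˡ f f' g zero    = *-distribʳ-+ (g 0) (f 0) (f' 0)
conv-+ˡ f f' g (suc m) = begin
  (f 0 + f' 0) * g (suc m) + conv (λ i → f (suc i) + f' (suc i)) g m
    ≡⟨ cong₂ _+_ (*-distribʳ-+ (g (suc m)) (f 0) (f' 0)) (conv-+ˡ _ _ g m) ⟩
  (f 0 * g (suc m) + f' 0 * g (suc m)) + (conv (λ i → f (suc i)) g m + conv (λ i → f' (suc i)) g m)
    ≡⟨ interchange (f 0 * g (suc m)) _ _ _ ⟩
  conv f g (suc m) + conv f' g (suc m) ∎

conv-below : ∀ (P : ℕ → ℕ → ℕ) g h m →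
             conv (λ i → below (P i) h) g m ≡ below (λ x → conv (λ i → P i x) g m) h
conv-below P g zero    m = conv-zeroˡ g (λ _ → refl) m
conv-below P g (suc h) m = refl

conv-move : ∀ (P : ℕ → ℕ → ℕ) g h m →
            conv (λ i → move (P i) h) g m ≡ move (λ x → conv (λ i → P i x) g m) h
conv-move P g h m = begin
  conv (λ i → P i (suc h) + below (P i) h + P i h) g m
    ≡⟨ conv-+ˡ (λ i → P i (suc h) + below (P i) h) (λ i → P i h) g m ⟩
  conv (λ i → P i (suc h) + below (P i) h) g m + conv (λ i → P i h) g m
    ≡⟨ cong (_+ conv (λ i → P i h) g m) (conv-+ˡ (λ i → P i (suc h)) (λ i → below (P i) h) g m) ⟩
  conv (λ i → P i (suc h)) g m + conv (λ i → below (P i) h) g m + conv (λ i → P i h) g m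
    ≡⟨ cong (λ z → conv (λ i → P i (suc h)) g m + z + conv (λ i → P i h) g m) (conv-below P g h m) ⟩
  move (λ x → conv (λ i → P i x) g m) h ∎

conv-cumulativeʳ : ∀ {E G} → E 0 ≡ 0 → (∀ j → E (suc j) ≡ G j + E j) →
                   ∀ f m → conv f E (suc m) ≡ conv f E m + conv f G m
conv-cumulativeʳ {E} {G} E0 Esuc f zero = begin
  f 0 * E 1 + f 1 * E 0            ≡⟨ cong₂ (λ x y → f 0 * x + f 1 * y) (Esuc 0) E0 ⟩
  f 0 * (G 0 + E 0) + f 1 * 0      ≡⟨ rearrange (f 0) (f 1) (G 0) (E 0) ⟩
  f 0 * E 0 + f 0 * G 0            ∎
  where
  rearrange : ∀ a b g e → a * (g + e) + b * 0 ≡ a * e + a * g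
  rearrange = solve-∀
conv-cumulativeʳ {E} {G} E0 Esuc f (suc m) = begin
  f 0 * E (suc (suc m)) + conv f₊ E (suc m)
    ≡⟨ cong₂ _+_ (cong (f 0 *_) (Esuc (suc m))) (conv-cumulativeʳ E0 Esuc f₊ m) ⟩
  f 0 * (G (suc m) + E (suc m)) + (conv f₊ E m + conv f₊ G m)
    ≡⟨ rearrange (f 0) (G (suc m)) (E (suc m)) (conv f₊ E m) (conv f₊ G m) ⟩
  conv f E (suc m) + conv f G (suc m) ∎
  where
  f₊ : ℕ → ℕ
  f₊ i = f (suc i)
  rearrange : ∀ a g e x y → a * (g + e) + (x + y) ≡ (a * e + x) + (a * g + y)
  rearrange = solve-∀

-- Duhamel's principle: feeding s m into height t at every time m, the solution is the
-- convolution of the source with the propagator paths i h t.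
duhamel : ∀ (X : ℕ → ℕ → ℕ) s t →
          (∀ h → X 0 h ≡ 0) →
          (∀ m h → X (suc m) h ≡ 𝟙 (h ≡ᵇ t) * s m + move (X m) h) →
          ∀ m h → X (suc m) h ≡ conv (λ i → paths i h t) s m
duhamel X s t X0 Xsuc zero h = begin
  X 1 h                              ≡⟨ Xsuc 0 h ⟩
  𝟙 (h ≡ᵇ t) * s 0 + move (X 0) h    ≡⟨ cong (𝟙 (h ≡ᵇ t) * s 0 +_) (move-cong X0 h) ⟩
  𝟙 (h ≡ᵇ t) * s 0 + move (λ _ → 0) h ≡⟨ cong (𝟙 (h ≡ᵇ t) * s 0 +_) (move-zero h) ⟩
  𝟙 (h ≡ᵇ t) * s 0 + 0               ≡⟨ +-identityʳ _ ⟩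
  paths 0 h t * s 0                  ∎
  where
  move-zero : ∀ h → move (λ _ → 0) h ≡ 0
  move-zero zero    = refl
  move-zero (suc h) = refl
duhamel X s t X0 Xsuc (suc m) h = begin
  X (suc (suc m)) h
    ≡⟨ Xsuc (suc m) h ⟩
  𝟙 (h ≡ᵇ t) * s (suc m) + move (X (suc m)) h
    ≡⟨ cong (𝟙 (h ≡ᵇ t) * s (suc m) +_) (move-cong (duhamel X s t X0 Xsuc m) h) ⟩
  𝟙 (h ≡ᵇ t) * s (suc m) + move (λ x → conv (λ i → paths i x t) s m) h
    ≡⟨ cong (𝟙 (h ≡ᵇ t) * s (suc m) +_) (conv-move (λ i x → paths i x t) s h m) ⟨
  conv (λ i → paths i h t) s (suc m) ∎

-- Cut a path from b + t + 1 down to 0 where it first reaches height t.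
paths-first-passage : ∀ t m b →
  conv (λ i → paths i b 0) (λ j → paths j t 0) m ≡ paths (suc m) (b + suc t) 0
paths-first-passage t zero b rewrite +-suc b t = base b t
  where
  base : ∀ b t → 𝟙 (b ≡ᵇ 0) * 𝟙 (t ≡ᵇ 0) ≡ paths 1 (suc (b + t)) 0
  base zero    zero    = refl
  base zero    (suc t) = refl
  base (suc b) zero    = refl
  base (suc b) (suc t) = refl
paths-first-passage t (suc m) b = begin
  𝟙 (b ≡ᵇ 0) * G (suc m) + conv (λ i → move (λ x → paths i x 0) b) G m
    ≡⟨ cong (𝟙 (b ≡ᵇ 0) * G (suc m) +_) (conv-move (λ i x → paths i x 0) G b m) ⟩
  𝟙 (b ≡ᵇ 0) * G (suc m) + move (λ x → conv (λ i → paths i x 0) G m) b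
    ≡⟨ cong (𝟙 (b ≡ᵇ 0) * G (suc m) +_) (move-cong (paths-first-passage t m) b) ⟩
  𝟙 (b ≡ᵇ 0) * G (suc m) + move (λ x → paths (suc m) (x + suc t) 0) b
    ≡⟨ last-cut b ⟩
  paths (suc (suc m)) (b + suc t) 0 ∎
  where
  G : ℕ → ℕ
  G j = paths j t 0
  last-cut : ∀ b → 𝟙 (b ≡ᵇ 0) * G (suc m) + move (λ x → paths (suc m) (x + suc t) 0) b
                   ≡ move (λ x → paths (suc m) x 0) (b + suc t)
  last-cut zero    = rearrange (G (suc m)) (paths (suc m) (suc (suc t)) 0) (paths (suc m) (suc t) 0)
    where
    rearrange : ∀ a x y → 1 * a + (x + 0 + y) ≡ x + a + y
    rearrange = solve-∀
  last-cut (suc b) rewrite +-suc b t = refl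

sumWords : ℕ → (List Step → ℕ) → ℕ
sumWords n f = sum (map f (stepWords n))

sum-map-prefixes : ∀ {A : Set} (f : List A → ℕ) ss ws →
  sum (map f (concatMap (λ s → map (s ∷_) ws) ss)) ≡ sum (map (λ s → sum (map (λ w → f (s ∷ w)) ws)) ss)
sum-map-prefixes f []       ws = refl
sum-map-prefixes f (s ∷ ss) ws = trans (sum-map-++ f (map (s ∷_) ws) _)
  (cong₂ _+_ (cong sum (sym (map-∘ ws))) (sum-map-prefixes f ss ws))

sumWords-suc : ∀ n f → sumWords (suc n) f ≡
  sumWords n (λ w → f (U ∷ w)) + sumWords n (λ w → f (D ∷ w)) + sumWords n (λ w → f (F ∷ w))
sumWords-suc n f = trans (sum-map-prefixes f allSteps (stepWords n))
  (reassoc (sumWords n (λ w → f (U ∷ w))) (sumWords n (λ w → f (D ∷ w))) (sumWords n (λ w → f (F ∷ w))))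
  where
  reassoc : ∀ a b c → a + (b + (c + 0)) ≡ a + b + c
  reassoc = solve-∀

isPathTo : ℕ → ℕ → List Step → Bool
isPathTo K h       []       = h ≡ᵇ K
isPathTo K h       (U ∷ w) = isPathTo K (suc h) w
isPathTo K zero    (D ∷ w) = false
isPathTo K (suc h) (D ∷ w) = isPathTo K h w
isPathTo K h       (F ∷ w) = isPathTo K h w

motzkinFrom≡isPathTo0 : ∀ h w → motzkinFrom h w ≡ isPathTo 0 h w
motzkinFrom≡isPathTo0 h       []      = refl
motzkinFrom≡isPathTo0 h       (U ∷ w) = motzkinFrom≡isPathTo0 (suc h) w
motzkinFrom≡isPathTo0 zero    (D ∷ w) = refl
motzkinFrom≡isPathTo0 (suc h) (D ∷ w) = motzkinFrom≡isPathTo0 h w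
motzkinFrom≡isPathTo0 h       (F ∷ w) = motzkinFrom≡isPathTo0 h w

count-isPathTo : ∀ K n h → sumWords n (𝟙 ∘ isPathTo K h) ≡ paths n h K
count-isPathTo K zero    h = +-identityʳ _
count-isPathTo K (suc n) h = begin
  sumWords (suc n) (𝟙 ∘ isPathTo K h)
    ≡⟨ sumWords-suc n (𝟙 ∘ isPathTo K h) ⟩
  sumWords n (𝟙 ∘ isPathTo K (suc h)) + sumWords n (λ w → 𝟙 (isPathTo K h (D ∷ w)))
    + sumWords n (𝟙 ∘ isPathTo K h)
    ≡⟨ cong₂ _+_ (cong₂ _+_ (count-isPathTo K n (suc h)) (down h)) (count-isPathTo K n h) ⟩
  paths (suc n) h K ∎
  where
  down : ∀ h → sumWords n (λ w → 𝟙 (isPathTo K h (D ∷ w))) ≡ below (λ x → paths n x K) h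
  down zero    = sum-map-zero (λ _ → refl) (stepWords n)
  down (suc h) = count-isPathTo K n h

count-motzkinFrom : ∀ n h → sumWords n (𝟙 ∘ motzkinFrom h) ≡ paths n h 0
count-motzkinFrom n h =
  trans (sum-map-cong (λ w → cong 𝟙 (motzkinFrom≡isPathTo0 h w)) (stepWords n)) (count-isPathTo 0 n h)

-- Humps

𝟙-≡ᵇ-* : ∀ (f : ℕ → ℕ) h t → 𝟙 (h ≡ᵇ t) * f h ≡ 𝟙 (h ≡ᵇ t) * f t
𝟙-≡ᵇ-* f h t with h ≡ᵇ t in eq
... | false = refl
... | true  = cong (λ x → 1 * f x) (≡ᵇ⇒≡ h t (subst T (sym eq) _))

module Humps (t : ℕ) where

  humpWeight : ℕ → List Step → ℕ
  humpWeight h w = if motzkinFrom h w then humpsFrom (suc t) h w else 0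

  humpTotal : ℕ → ℕ → ℕ
  humpTotal n h = sumWords n (humpWeight h)

  -- continuations F⋯F D ⋯ back to the axis of a hump whose up step reached height h
  flatsDownTotal : ℕ → ℕ → ℕ
  flatsDownTotal n h = sumWords n (λ w → 𝟙 (motzkinFrom h w ∧ flatsThenDown w))

  HM≡humpTotal : ∀ n → HM n (suc t) ≡ humpTotal n 0
  HM≡humpTotal n = sum-map-filter isMotzkin (humps (suc t)) (stepWords n)

  flatsDownTotal-zero : ∀ h → flatsDownTotal 0 h ≡ 0
  flatsDownTotal-zero h = cong (λ b → 𝟙 b + 0) (∧-zeroʳ (h ≡ᵇ 0))

  flatsDownTotal-suc : ∀ n h → flatsDownTotal (suc n) h ≡ below (λ x → paths n x 0) h + flatsDownTotal n h
  flatsDownTotal-suc n h = begin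
    flatsDownTotal (suc n) h
      ≡⟨ sumWords-suc n _ ⟩
    sumWords n (λ w → 𝟙 (motzkinFrom (suc h) w ∧ false))
      + sumWords n (λ w → 𝟙 (motzkinFrom h (D ∷ w) ∧ true)) + flatsDownTotal n h
      ≡⟨ cong₂ (λ x y → x + y + flatsDownTotal n h) up (down h) ⟩
    below (λ x → paths n x 0) h + flatsDownTotal n h ∎
    where
    up : sumWords n (λ w → 𝟙 (motzkinFrom (suc h) w ∧ false)) ≡ 0
    up = sum-map-zero (λ w → cong 𝟙 (∧-zeroʳ (motzkinFrom (suc h) w))) (stepWords n)
    down : ∀ h → sumWords n (λ w → 𝟙 (motzkinFrom h (D ∷ w) ∧ true)) ≡ below (λ x → paths n x 0) h
    down zero    = sum-map-zero (λ _ → refl) (stepWords n)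
    down (suc h) = trans (sum-map-cong (λ w → cong 𝟙 (∧-identityʳ (motzkinFrom h w))) (stepWords n))
                         (count-motzkinFrom n h)

  humpTotal-zero : ∀ h → humpTotal 0 h ≡ 0
  humpTotal-zero zero    = refl
  humpTotal-zero (suc h) = refl

  humpWeight-up : ∀ h w → humpWeight h (U ∷ w) ≡
    𝟙 (h ≡ᵇ t) * 𝟙 (motzkinFrom (suc h) w ∧ flatsThenDown w) + humpWeight (suc h) w
  humpWeight-up h w with motzkinFrom (suc h) w | flatsThenDown w | h ≡ᵇ t
  ... | false | _     | b     = sym (trans (+-identityʳ (𝟙 b * 0)) (*-zeroʳ (𝟙 b)))
  ... | true  | false | false = refl
  ... | true  | false | true  = refl
  ... | true  | true  | false = refl
  ... | true  | true  | true  = refl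

  humpTotal-suc : ∀ n h → humpTotal (suc n) h ≡ 𝟙 (h ≡ᵇ t) * flatsDownTotal n (suc t) + move (humpTotal n) h
  humpTotal-suc n h = begin
    humpTotal (suc n) h
      ≡⟨ sumWords-suc n (humpWeight h) ⟩
    sumWords n (λ w → humpWeight h (U ∷ w)) + sumWords n (λ w → humpWeight h (D ∷ w)) + humpTotal n h
      ≡⟨ cong (λ x → x + sumWords n (λ w → humpWeight h (D ∷ w)) + humpTotal n h) up ⟩
    𝟙 (h ≡ᵇ t) * flatsDownTotal n (suc t) + humpTotal n (suc h)
      + sumWords n (λ w → humpWeight h (D ∷ w)) + humpTotal n h
      ≡⟨ cong (λ x → 𝟙 (h ≡ᵇ t) * flatsDownTotal n (suc t) + humpTotal n (suc h) + x + humpTotal n h)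
              (down h) ⟩
    𝟙 (h ≡ᵇ t) * flatsDownTotal n (suc t) + humpTotal n (suc h) + below (humpTotal n) h + humpTotal n h
      ≡⟨ reassoc (𝟙 (h ≡ᵇ t) * flatsDownTotal n (suc t)) (humpTotal n (suc h)) _ _ ⟩
    𝟙 (h ≡ᵇ t) * flatsDownTotal n (suc t) + move (humpTotal n) h ∎
    where
    reassoc : ∀ a b c d → a + b + c + d ≡ a + (b + c + d)
    reassoc = solve-∀
    up : sumWords n (λ w → humpWeight h (U ∷ w)) ≡ 𝟙 (h ≡ᵇ t) * flatsDownTotal n (suc t) + humpTotal n (suc h)
    up = begin
      sumWords n (λ w → humpWeight h (U ∷ w))
        ≡⟨ sum-map-cong (humpWeight-up h) (stepWords n) ⟩
      sumWords n (λ w → 𝟙 (h ≡ᵇ t) * 𝟙 (motzkinFrom (suc h) w ∧ flatsThenDown w) + humpWeight (suc h) w)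
        ≡⟨ sum-map-+ _ (humpWeight (suc h)) (stepWords n) ⟩
      sumWords n (λ w → 𝟙 (h ≡ᵇ t) * 𝟙 (motzkinFrom (suc h) w ∧ flatsThenDown w)) + humpTotal n (suc h)
        ≡⟨ cong (_+ humpTotal n (suc h)) (sum-map-*ˡ (𝟙 (h ≡ᵇ t)) _ (stepWords n)) ⟩
      𝟙 (h ≡ᵇ t) * flatsDownTotal n (suc h) + humpTotal n (suc h)
        ≡⟨ cong (_+ humpTotal n (suc h)) (𝟙-≡ᵇ-* (λ x → flatsDownTotal n (suc x)) h t) ⟩
      𝟙 (h ≡ᵇ t) * flatsDownTotal n (suc t) + humpTotal n (suc h) ∎
    down : ∀ h → sumWords n (λ w → humpWeight h (D ∷ w)) ≡ below (humpTotal n) h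
    down zero    = sum-map-zero (λ _ → refl) (stepWords n)
    down (suc h) = refl

  HM-step : ∀ m → HM (suc (suc m)) (suc t) ≡ HM (suc m) (suc t) + paths (suc m) (t + suc t) 0
  HM-step m = begin
    HM (suc (suc m)) (suc t)
      ≡⟨ trans (HM≡humpTotal (suc (suc m))) (solution (suc m)) ⟩
    conv (λ i → paths i 0 t) E (suc m)
      ≡⟨ conv-cumulativeʳ (flatsDownTotal-zero (suc t)) (λ j → flatsDownTotal-suc j (suc t)) _ m ⟩
    conv (λ i → paths i 0 t) E m + conv (λ i → paths i 0 t) G m
      ≡⟨ cong₂ _+_ (sym (trans (HM≡humpTotal (suc m)) (solution m)))
                   (conv-congˡ G (λ i → paths-sym i 0 t) m) ⟩
    HM (suc m) (suc t) + conv G G m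
      ≡⟨ cong (HM (suc m) (suc t) +_) (paths-first-passage t m t) ⟩
    HM (suc m) (suc t) + paths (suc m) (t + suc t) 0 ∎
    where
    E G : ℕ → ℕ
    E j = flatsDownTotal j (suc t)
    G j = paths j t 0
    solution : ∀ m → humpTotal (suc m) 0 ≡ conv (λ i → paths i 0 t) E m
    solution m = duhamel humpTotal E t humpTotal-zero humpTotal-suc m 0

-- Tableau words

-- The flag records whether a down step has occurred; flat steps are forbidden before it.
isTableauWord : ℕ → ℕ → Bool → List Step → Bool
isTableauWord K h       d []      = h ≡ᵇ K
isTableauWord K h       d (U ∷ w) = isTableauWord K (suc h) d w
isTableauWord K zero    d (D ∷ w) = false
isTableauWord K (suc h) d (D ∷ w) = isTableauWord K h true w
isTableauWord K h       d (F ∷ w) = d ∧ isTableauWord K h d w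

isTableauWord-true : ∀ K h w → isTableauWord K h true w ≡ isPathTo K h w
isTableauWord-true K h       []      = refl
isTableauWord-true K h       (U ∷ w) = isTableauWord-true K (suc h) w
isTableauWord-true K zero    (D ∷ w) = refl
isTableauWord-true K (suc h) (D ∷ w) = isTableauWord-true K h w
isTableauWord-true K h       (F ∷ w) = isTableauWord-true K h w

-- paths from h to K of length m whose first step other than U is a D (or which consist of U steps only)
downFirst : ℕ → ℕ → ℕ → ℕ
downFirst K zero    h = 𝟙 (h ≡ᵇ K)
downFirst K (suc m) h = downFirst K m (suc h) + below (λ x → paths m x K) h

-- paths from h to K of length m whose first step other than U is an F
flatFirst : ℕ → ℕ → ℕ → ℕ
flatFirst K zero    h = 0
flatFirst K (suc m) h = flatFirst K m (suc h) + paths m h K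

paths≡downFirst+flatFirst : ∀ K m h → paths m h K ≡ downFirst K m h + flatFirst K m h
paths≡downFirst+flatFirst K zero    h = sym (+-identityʳ _)
paths≡downFirst+flatFirst K (suc m) h = begin
  paths m (suc h) K + below (λ x → paths m x K) h + paths m h K
    ≡⟨ cong (λ z → z + below (λ x → paths m x K) h + paths m h K) (paths≡downFirst+flatFirst K m (suc h)) ⟩
  downFirst K m (suc h) + flatFirst K m (suc h) + below (λ x → paths m x K) h + paths m h K
    ≡⟨ rearrange (downFirst K m (suc h)) (flatFirst K m (suc h)) _ _ ⟩
  downFirst K (suc m) h + flatFirst K (suc m) h ∎
  where
  rearrange : ∀ a b c d → a + b + c + d ≡ a + c + (b + d)
  rearrange = solve-∀

-- Turning the first non-U step D into F matches the two kinds bijectively, up to the all-U path.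
downFirst≡flatFirst : ∀ K m h →
  downFirst K (suc m) (suc h) ≡ flatFirst K (suc m) h + 𝟙 (suc (suc (m + h)) ≡ᵇ K)
downFirst≡flatFirst K zero    h = +-comm (𝟙 (suc (suc h) ≡ᵇ K)) (𝟙 (h ≡ᵇ K))
downFirst≡flatFirst K (suc m) h = begin
  downFirst K (suc m) (suc (suc h)) + paths (suc m) h K
    ≡⟨ cong (_+ paths (suc m) h K) (downFirst≡flatFirst K m (suc h)) ⟩
  flatFirst K (suc m) (suc h) + 𝟙 (suc (suc (m + suc h)) ≡ᵇ K) + paths (suc m) h K
    ≡⟨ cong (λ z → flatFirst K (suc m) (suc h) + 𝟙 (suc (suc z) ≡ᵇ K) + paths (suc m) h K) (+-suc m h) ⟩
  flatFirst K (suc m) (suc h) + 𝟙 (suc (suc (suc (m + h))) ≡ᵇ K) + paths (suc m) h K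
    ≡⟨ +-right-comm (flatFirst K (suc m) (suc h)) _ _ ⟩
  flatFirst K (suc (suc m)) h + 𝟙 (suc (suc (suc m + h)) ≡ᵇ K) ∎
  where
  +-right-comm : ∀ a b c → a + b + c ≡ a + c + b
  +-right-comm = solve-∀

downFirst-step : ∀ K n → downFirst K (suc n) 0 + downFirst K n 0 ≡ paths n 0 K + 𝟙 (suc n ≡ᵇ K)
downFirst-step K zero    = trans (cong (_+ 𝟙 (0 ≡ᵇ K)) (+-identityʳ _)) (+-comm (𝟙 (1 ≡ᵇ K)) _)
downFirst-step K (suc m) = begin
  downFirst K (suc m) 1 + 0 + downFirst K (suc m) 0
    ≡⟨ cong (_+ downFirst K (suc m) 0) (trans (+-identityʳ _) (downFirst≡flatFirst K m 0)) ⟩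
  flatFirst K (suc m) 0 + 𝟙 (suc (suc (m + 0)) ≡ᵇ K) + downFirst K (suc m) 0
    ≡⟨ cong (λ z → flatFirst K (suc m) 0 + 𝟙 (suc (suc z) ≡ᵇ K) + downFirst K (suc m) 0) (+-identityʳ m) ⟩
  flatFirst K (suc m) 0 + 𝟙 (suc (suc m) ≡ᵇ K) + downFirst K (suc m) 0
    ≡⟨ rearrange (flatFirst K (suc m) 0) _ _ ⟩
  downFirst K (suc m) 0 + flatFirst K (suc m) 0 + 𝟙 (suc (suc m) ≡ᵇ K)
    ≡⟨ cong (_+ 𝟙 (suc (suc m) ≡ᵇ K)) (paths≡downFirst+flatFirst K (suc m) 0) ⟨
  paths (suc m) 0 K + 𝟙 (suc (suc m) ≡ᵇ K) ∎
  where
  rearrange : ∀ a b c → a + b + c ≡ c + a + b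
  rearrange = solve-∀

count-isTableauWord : ∀ K n h → sumWords n (𝟙 ∘ isTableauWord K h false) ≡ downFirst K n h
count-isTableauWord K zero    h = +-identityʳ _
count-isTableauWord K (suc n) h = begin
  sumWords (suc n) (𝟙 ∘ isTableauWord K h false)
    ≡⟨ sumWords-suc n (𝟙 ∘ isTableauWord K h false) ⟩
  sumWords n (𝟙 ∘ isTableauWord K (suc h) false) + sumWords n (λ w → 𝟙 (isTableauWord K h false (D ∷ w)))
    + sumWords n (λ _ → 0)
    ≡⟨ cong₂ _+_ (cong₂ _+_ (count-isTableauWord K n (suc h)) (down h))
                 (sum-map-zero (λ _ → refl) (stepWords n)) ⟩
  downFirst K (suc n) h + 0
    ≡⟨ +-identityʳ _ ⟩
  downFirst K (suc n) h ∎
  where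
  down : ∀ h → sumWords n (λ w → 𝟙 (isTableauWord K h false (D ∷ w))) ≡ below (λ x → paths n x K) h
  down zero    = sum-map-zero (λ _ → refl) (stepWords n)
  down (suc h) = trans (sum-map-cong (λ w → cong 𝟙 (isTableauWord-true K h w)) (stepWords n))
                       (count-isPathTo K n h)

increasing-∷ : ∀ {x} xs → All (x <_) xs → T (strictlyIncreasing xs) → T (strictlyIncreasing (x ∷ xs))
increasing-∷ []       _           _  = _
increasing-∷ (y ∷ ys) (x<y ∷ _) si = ∧⁺ (<⇒<ᵇ x<y) si

increasing-tail : ∀ {x} xs → T (strictlyIncreasing (x ∷ xs)) → T (strictlyIncreasing xs)
increasing-tail []       _  = _
increasing-tail (y ∷ ys) si = proj₂ (∧⁻ si)

increasing-head : ∀ {x} xs → T (strictlyIncreasing (x ∷ xs)) → All (x <_) xs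
increasing-head {x} []       _  = []
increasing-head {x} (y ∷ ys) si = x<y ∷ All.map (<-trans x<y) (increasing-head ys (proj₂ (∧⁻ si)))
  where
  x<y : x < y
  x<y = <ᵇ⇒< x y (proj₁ (∧⁻ si))

Within-tail : ∀ {i n j} → i < j → Within i (suc n) j → Within (suc i) n j
Within-tail {i} {n} {j} i<j (_ , j<) = i<j , subst (j <_) (+-suc i n) j<

Within-head : ∀ {i n j} → Within i (suc n) j → j ≡ i ⊎ Within (suc i) n j
Within-head (i≤j , j<) with m≤n⇒m<n∨m≡n i≤j
... | inj₁ i<j  = inj₂ (Within-tail i<j (i≤j , j<))
... | inj₂ refl = inj₁ refl

Within-init : ∀ {i n j} → Within (suc i) n j → Within i (suc n) j
Within-init {i} {n} {j} (i<j , j<) = <⇒≤ i<j , subst (j <_) (sym (+-suc i n)) j<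

sameStep : Step → Step → Bool
sameStep U U = true
sameStep D D = true
sameStep F F = true
sameStep _ _ = false

positions : Step → List Step → ℕ → List ℕ
positions s []      i = []
positions s (x ∷ w) i = if sameStep x s then i ∷ positions s w (suc i) else positions s w (suc i)

positions-within : ∀ s w i → All (Within i (length w)) (positions s w i)
positions-within s []      i = []
positions-within s (x ∷ w) i with sameStep x s
... | true  = (≤-refl , m<m+n i z<s) ∷ All.map Within-init (positions-within s w (suc i))
... | false = All.map Within-init (positions-within s w (suc i))

positions-sorted : ∀ s w i → T (strictlyIncreasing (positions s w i))
positions-sorted s []      i = _
positions-sorted s (x ∷ w) i with sameStep x s
... | true  = increasing-∷ (positions s w (suc i)) (All.map proj₁ (positions-within s w (suc i)))
                      (positions-sorted s w (suc i))
... | false = positions-sorted s w (suc i)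

positions-length : ∀ w i →
  length (positions U w i) + length (positions D w i) + length (positions F w i) ≡ length w
positions-length []      i = refl
positions-length (U ∷ w) i = cong suc (positions-length w (suc i))
positions-length (D ∷ w) i =
  trans (cong (_+ length (positions F w (suc i))) (+-suc (length (positions U w (suc i))) _))
        (cong suc (positions-length w (suc i)))
positions-length (F ∷ w) i = trans (+-suc _ _) (cong suc (positions-length w (suc i)))

occurrences-positions-head : ∀ s x w i → occurrences i (positions s (x ∷ w) i) ≡ 𝟙 (sameStep x s)
occurrences-positions-head s x w i with sameStep x s
... | true  = trans (occurrences-head i (positions s w (suc i)))
                    (cong suc (occurrences-below _ (All.map proj₁ (positions-within s w (suc i)))))
... | false = occurrences-below _ (All.map proj₁ (positions-within s w (suc i)))

occurrences-positions-tail : ∀ s x w {i j} → i < j →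
  occurrences j (positions s (x ∷ w) i) ≡ occurrences j (positions s w (suc i))
occurrences-positions-tail s x w {i} i<j with sameStep x s
... | true  = occurrences-skip (positions s w (suc i)) (≢-sym (<⇒≢ i<j))
... | false = refl

positions-once : ∀ w i {j} → Within i (length w) j →
  occurrences j (positions U w i) + occurrences j (positions D w i) + occurrences j (positions F w i) ≡ 1
positions-once []      i (i≤j , j<) = ⊥-elim (<⇒≱ j< (subst (_≤ _) (sym (+-identityʳ i)) i≤j))
positions-once (x ∷ w) i j∈ with Within-head j∈
... | inj₁ refl =
  trans (cong₂ _+_ (cong₂ _+_ (occurrences-positions-head U x w i) (occurrences-positions-head D x w i))
                   (occurrences-positions-head F x w i))
        (one-letter x)
  where
  one-letter : ∀ x → 𝟙 (sameStep x U) + 𝟙 (sameStep x D) + 𝟙 (sameStep x F) ≡ 1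
  one-letter U = refl
  one-letter D = refl
  one-letter F = refl
... | inj₂ j∈′ = trans (cong₂ _+_ (cong₂ _+_ (occurrences-positions-tail U x w (proj₁ j∈′))
                                              (occurrences-positions-tail D x w (proj₁ j∈′)))
                                  (occurrences-positions-tail F x w (proj₁ j∈′)))
                       (positions-once w (suc i) j∈′)

lettersFrom : (ℕ → Step) → ℕ → ℕ → List Step
lettersFrom f i zero    = []
lettersFrom f i (suc n) = f i ∷ lettersFrom f (suc i) n

length-lettersFrom : ∀ f i n → length (lettersFrom f i n) ≡ n
length-lettersFrom f i zero    = refl
length-lettersFrom f i (suc n) = cong suc (length-lettersFrom f (suc i) n)

lettersFrom-cong : ∀ {f g} i n → (∀ {j} → i ≤ j → f j ≡ g j) → lettersFrom f i n ≡ lettersFrom g i n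
lettersFrom-cong i zero    f≡g = refl
lettersFrom-cong i (suc n) f≡g = cong₂ _∷_ (f≡g ≤-refl) (lettersFrom-cong (suc i) n (f≡g ∘ <⇒≤))

positions-lettersFrom : ∀ f s n i r → T (strictlyIncreasing r) → All (Within i n) r →
  (∀ {j} → Within i n j → sameStep (f j) s ≡ (occurrences j r ≡ᵇ 1)) →
  positions s (lettersFrom f i n) i ≡ r
positions-lettersFrom f s zero i []      _ _                _ = refl
positions-lettersFrom f s zero i (x ∷ r) _ ((i≤x , x<) ∷ _) _ =
  ⊥-elim (<⇒≱ x< (subst (_≤ x) (sym (+-identityʳ i)) i≤x))
positions-lettersFrom f s (suc n) i [] _ _ marks rewrite marks (≤-refl , m<m+n i z<s) =
  positions-lettersFrom f s n (suc i) [] _ [] (marks ∘ Within-init)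
positions-lettersFrom f s (suc n) i (x ∷ r) si (x∈ ∷ r∈) marks with Within-head x∈
... | inj₁ refl
  rewrite marks (≤-refl , m<m+n i z<s) | occurrences-head i r | occurrences-below r (increasing-head r si) =
  cong (i ∷_) (positions-lettersFrom f s n (suc i) r (increasing-tail r si) r∈′ marks′)
  where
  r∈′ : All (Within (suc i) n) r
  r∈′ = All.zipWith (λ (i<y , y∈) → Within-tail i<y y∈) (increasing-head r si , r∈)
  marks′ : ∀ {j} → Within (suc i) n j → sameStep (f j) s ≡ (occurrences j r ≡ᵇ 1)
  marks′ j∈ = trans (marks (Within-init j∈)) (cong (_≡ᵇ 1) (occurrences-skip r (≢-sym (<⇒≢ (proj₁ j∈)))))
... | inj₂ x∈′ rewrite marks (≤-refl , m<m+n i z<s)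
                    | occurrences-below (x ∷ r) (proj₁ x∈′ ∷ All.map (<-trans (proj₁ x∈′)) (increasing-head r si)) =
  positions-lettersFrom f s n (suc i) (x ∷ r) si (x∈′ ∷ r∈′) (marks ∘ Within-init)
  where
  r∈′ : All (Within (suc i) n) r
  r∈′ = All.zipWith (λ (x<y , y∈) → Within-tail (<-trans (proj₁ x∈′) x<y) y∈) (increasing-head r si , r∈)

letterFor : ℕ → ℕ → Step
letterFor a b = if a ≡ᵇ 1 then U else if b ≡ᵇ 1 then D else F

letterAt : List ℕ → List ℕ → ℕ → Step
letterAt r₁ r₂ j = letterFor (occurrences j r₁) (occurrences j r₂)

letterAt-positions-head : ∀ x w i → letterAt (positions U (x ∷ w) i) (positions D (x ∷ w) i) i ≡ x
letterAt-positions-head x w i rewrite occurrences-positions-head U x w i | occurrences-positions-head D x w i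
  with x
... | U = refl
... | D = refl
... | F = refl

letterAt-positions-tail : ∀ x w i {j} → suc i ≤ j →
  letterAt (positions U (x ∷ w) i) (positions D (x ∷ w) i) j
    ≡ letterAt (positions U w (suc i)) (positions D w (suc i)) j
letterAt-positions-tail x w i i<j
  rewrite occurrences-positions-tail U x w i<j | occurrences-positions-tail D x w i<j = refl

lettersFrom-positions : ∀ w i → lettersFrom (letterAt (positions U w i) (positions D w i)) i (length w) ≡ w
lettersFrom-positions []      i = refl
lettersFrom-positions (x ∷ w) i = cong₂ _∷_ (letterAt-positions-head x w i)
  (trans (lettersFrom-cong (suc i) (length w) (letterAt-positions-tail x w i))
         (lettersFrom-positions w (suc i)))

record Partition₃ (n : ℕ) (r₁ r₂ c : List ℕ) : Set where
  field
    within₁ : All (Within 1 n) r₁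
    within₂ : All (Within 1 n) r₂
    within₃ : All (Within 1 n) c
    sorted₁ : T (strictlyIncreasing r₁)
    sorted₂ : T (strictlyIncreasing r₂)
    sorted₃ : T (strictlyIncreasing c)
    once    : ∀ {j} → Within 1 n j → occurrences j r₁ + occurrences j r₂ + occurrences j c ≡ 1
    size    : length r₁ + length r₂ + length c ≡ n

record TableauRows (K n : ℕ) (r₁ r₂ c : List ℕ) : Set where
  field
    partition : Partition₃ n r₁ r₂ c
    column₁   : T (belowOK r₁ r₂)
    column₂   : T (belowOK r₂ (take 1 c))
    excess    : length r₁ ≡ length r₂ + K
  open Partition₃ partition public

positions-partition : ∀ w → Partition₃ (length w) (positions U w 1) (positions D w 1) (positions F w 1)
positions-partition w = record
  { within₁ = positions-within U w 1 ; within₂ = positions-within D w 1 ; within₃ = positions-within F w 1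
  ; sorted₁ = positions-sorted U w 1 ; sorted₂ = positions-sorted D w 1 ; sorted₃ = positions-sorted F w 1
  ; once    = positions-once w 1
  ; size    = positions-length w 1 }

sameStep-letterFor : ∀ a b c → a + b + c ≡ 1 →
  sameStep (letterFor a b) U ≡ (a ≡ᵇ 1) × sameStep (letterFor a b) D ≡ (b ≡ᵇ 1) ×
  sameStep (letterFor a b) F ≡ (c ≡ᵇ 1)
sameStep-letterFor zero          zero          (suc zero)    refl = refl , refl , refl
sameStep-letterFor zero          (suc zero)    zero          refl = refl , refl , refl
sameStep-letterFor (suc zero)    zero          zero          refl = refl , refl , refl
sameStep-letterFor zero          zero          zero          ()
sameStep-letterFor zero          zero          (suc (suc c)) ()
sameStep-letterFor zero          (suc zero)    (suc c)       ()
sameStep-letterFor zero          (suc (suc b)) c             ()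
sameStep-letterFor (suc zero)    zero          (suc c)       ()
sameStep-letterFor (suc zero)    (suc b)       c             ()
sameStep-letterFor (suc (suc a)) b             c             ()

encode : List ℕ → List ℕ → ℕ → List Step
encode r₁ r₂ n = lettersFrom (letterAt r₁ r₂) 1 n

positions-encode : ∀ {n r₁ r₂ c} → Partition₃ n r₁ r₂ c →
  positions U (encode r₁ r₂ n) 1 ≡ r₁ × positions D (encode r₁ r₂ n) 1 ≡ r₂ ×
  positions F (encode r₁ r₂ n) 1 ≡ c
positions-encode {n} {r₁} {r₂} {c} p =
  positions-lettersFrom _ U n 1 r₁ sorted₁ within₁ (proj₁ ∘ marks-at) ,
  positions-lettersFrom _ D n 1 r₂ sorted₂ within₂ (proj₁ ∘ proj₂ ∘ marks-at) ,
  positions-lettersFrom _ F n 1 c  sorted₃ within₃ (proj₂ ∘ proj₂ ∘ marks-at)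
  where
  open Partition₃ p
  marks-at : ∀ {j} → Within 1 n j →
    (sameStep (letterAt r₁ r₂ j) U ≡ (occurrences j r₁ ≡ᵇ 1)) ×
    (sameStep (letterAt r₁ r₂ j) D ≡ (occurrences j r₂ ≡ᵇ 1)) ×
    (sameStep (letterAt r₁ r₂ j) F ≡ (occurrences j c ≡ᵇ 1))
  marks-at {j} j∈ = sameStep-letterFor (occurrences j r₁) (occurrences j r₂) (occurrences j c) (once j∈)

length-∷ʳ : ∀ {h} (a : List ℕ) i → length a ≡ h → length (a ∷ʳ i) ≡ suc h
length-∷ʳ a i |a| = trans (length-++ a) (trans (+-comm (length a) 1) (cong suc |a|))

module _ (K : ℕ) where

  -- a: the first-row entries read so far that still wait for a second-row entry below them
  tableauWord⇒column₁ : ∀ w i h d (a : List ℕ) → T (isTableauWord K h d w) → length a ≡ h → All (_< i) a →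
                        T (belowOK (a ++ positions U w i) (positions D w i))
  tableauWord⇒column₁ []      i h       d a       t |a| a<i = _
  tableauWord⇒column₁ (U ∷ w) i h       d a       t |a| a<i rewrite sym (∷ʳ-++ a i (positions U w (suc i))) =
    tableauWord⇒column₁ w (suc i) (suc h) d (a ∷ʳ i) t (length-∷ʳ a i |a|)
      (All.++⁺ (All.map m<n⇒m<1+n a<i) (n<1+n i ∷ []))
  tableauWord⇒column₁ (D ∷ w) i zero    d a       () |a| a<i
  tableauWord⇒column₁ (D ∷ w) i (suc h) d (x ∷ a) t |a| (x<i ∷ a<i) =
    ∧⁺ (<⇒<ᵇ x<i) (tableauWord⇒column₁ w (suc i) h true a t (suc-injective |a|) (All.map m<n⇒m<1+n a<i))
  tableauWord⇒column₁ (F ∷ w) i h       d a       t |a| a<i =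
    tableauWord⇒column₁ w (suc i) h d a (proj₂ (∧⁻ {d} t)) |a| (All.map m<n⇒m<1+n a<i)

  tableauWord⇒column₂ : ∀ w i h → T (isTableauWord K h false w) →
                        T (belowOK (positions D w i) (take 1 (positions F w i)))
  tableauWord⇒column₂ []      i h       t = _
  tableauWord⇒column₂ (U ∷ w) i h       t = tableauWord⇒column₂ w (suc i) (suc h) t
  tableauWord⇒column₂ (D ∷ w) i zero    ()
  tableauWord⇒column₂ (D ∷ w) i (suc h) t =
    first-flat-later (positions F w (suc i)) (All.map proj₁ (positions-within F w (suc i)))
    where
    first-flat-later : ∀ l → All (suc i ≤_) l → T (belowOK (i ∷ positions D w (suc i)) (take 1 l))
    first-flat-later []      _           = _
    first-flat-later (f ∷ l) (i<f ∷ _) = ∧⁺ (<⇒<ᵇ i<f) _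
  tableauWord⇒column₂ (F ∷ w) i h ()

  tableauWord⇒excess : ∀ w i h d → T (isTableauWord K h d w) →
                       length (positions U w i) + h ≡ length (positions D w i) + K
  tableauWord⇒excess []      i h       d t = ≡ᵇ⇒≡ h K t
  tableauWord⇒excess (U ∷ w) i h       d t =
    trans (sym (+-suc _ h)) (tableauWord⇒excess w (suc i) (suc h) d t)
  tableauWord⇒excess (D ∷ w) i zero    d ()
  tableauWord⇒excess (D ∷ w) i (suc h) d t =
    trans (+-suc _ h) (cong suc (tableauWord⇒excess w (suc i) h true t))
  tableauWord⇒excess (F ∷ w) i h       d t = tableauWord⇒excess w (suc i) h d (proj₂ (∧⁻ {d} t))

  columns⇒tableauWord : ∀ w i h d (a : List ℕ) → length a ≡ h → All (_< i) a →
    T (belowOK (a ++ positions U w i) (positions D w i)) →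
    d ≡ true ⊎ T (belowOK (positions D w i) (take 1 (positions F w i))) →
    length (positions U w i) + h ≡ length (positions D w i) + K →
    T (isTableauWord K h d w)
  columns⇒tableauWord []      i h d a |a| a<i col₁ col₂ exc = ≡⇒≡ᵇ h K exc
  columns⇒tableauWord (U ∷ w) i h d a |a| a<i col₁ col₂ exc =
    columns⇒tableauWord w (suc i) (suc h) d (a ∷ʳ i) (length-∷ʳ a i |a|)
      (All.++⁺ (All.map m<n⇒m<1+n a<i) (n<1+n i ∷ []))
      (subst (λ r → T (belowOK r (positions D w (suc i)))) (sym (∷ʳ-++ a i (positions U w (suc i)))) col₁)
      col₂ (trans (+-suc _ h) exc)
  columns⇒tableauWord (D ∷ w) i zero d [] |a| a<i col₁ col₂ exc =
    ⊥-elim (no-partner (positions U w (suc i)) (All.map proj₁ (positions-within U w (suc i))) col₁)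
    where
    no-partner : ∀ l → All (suc i ≤_) l → ¬ T (belowOK l (i ∷ positions D w (suc i)))
    no-partner []      _           ()
    no-partner (u ∷ l) (i<u ∷ _) t = <⇒≱ (<ᵇ⇒< u i (proj₁ (∧⁻ t))) (<⇒≤ i<u)
  columns⇒tableauWord (D ∷ w) i (suc h) d (x ∷ a) |a| (x<i ∷ a<i) col₁ col₂ exc =
    columns⇒tableauWord w (suc i) h true a (suc-injective |a|) (All.map m<n⇒m<1+n a<i)
      (proj₂ (∧⁻ {x <ᵇ i} col₁)) (inj₁ refl) (suc-injective (trans (sym (+-suc _ h)) exc))
  columns⇒tableauWord (F ∷ w) i h true a |a| a<i col₁ col₂ exc =
    columns⇒tableauWord w (suc i) h true a |a| (All.map m<n⇒m<1+n a<i) col₁ (inj₁ refl) exc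
  columns⇒tableauWord (F ∷ w) i h false a |a| a<i col₁ (inj₂ col₂) exc =
    ⊥-elim (no-down-before (positions D w (suc i)) (All.map proj₁ (positions-within D w (suc i))) col₂)
    where
    no-down-before : ∀ l → All (suc i ≤_) l → ¬ T (belowOK l (take 1 (i ∷ positions F w (suc i))))
    no-down-before []      _           ()
    no-down-before (x ∷ l) (i<x ∷ _) t = <⇒≱ (<ᵇ⇒< x i (proj₁ (∧⁻ t))) (<⇒≤ i<x)

  tableauWord⇒rows : ∀ w → T (isTableauWord K 0 false w) →
                     TableauRows K (length w) (positions U w 1) (positions D w 1) (positions F w 1)
  tableauWord⇒rows w t = record
    { partition = positions-partition w
    ; column₁   = tableauWord⇒column₁ w 1 0 false [] t refl []
    ; column₂   = tableauWord⇒column₂ w 1 0 t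
    ; excess    = trans (sym (+-identityʳ _)) (tableauWord⇒excess w 1 0 false t) }

  rows⇒tableauWord : ∀ {n r₁ r₂ c} → TableauRows K n r₁ r₂ c →
    let w = encode r₁ r₂ n in
    positions U w 1 ≡ r₁ × positions D w 1 ≡ r₂ × positions F w 1 ≡ c × T (isTableauWord K 0 false w)
  rows⇒tableauWord {n} {r₁} {r₂} {c} rows with positions-encode (TableauRows.partition rows)
  ... | pos₁ , pos₂ , pos₃ = pos₁ , pos₂ , pos₃ ,
    columns⇒tableauWord (encode r₁ r₂ n) 1 0 false [] refl []
      (subst₂ (λ x y → T (belowOK x y)) (sym pos₁) (sym pos₂) column₁)
      (inj₂ (subst₂ (λ x y → T (belowOK x (take 1 y))) (sym pos₂) (sym pos₃) column₂))
      (trans (+-identityʳ _) (trans (cong length pos₁) (trans excess (cong (λ r → length r + K) (sym pos₂)))))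
    where open TableauRows rows

-- Tableaux

-- first row r₁, second row r₂, and the entries c of the first column below them
tableau : List ℕ → List ℕ → List ℕ → Filling
tableau r₁ []       c = r₁ ∷ []
tableau r₁ (x ∷ r₂) c = r₁ ∷ (x ∷ r₂) ∷ map [_] c

concat-tableau : ∀ r₁ r₂ c → (r₂ ≡ [] → c ≡ []) → concat (tableau r₁ r₂ c) ≡ r₁ ++ r₂ ++ c
concat-tableau r₁ []       c c-empty rewrite c-empty refl = refl
concat-tableau r₁ (x ∷ r₂) c _ = cong (λ l → r₁ ++ (x ∷ r₂) ++ l) (concat-map-[ c ])

columnsOK-singletons⁺ : ∀ c → T (strictlyIncreasing c) → T (columnsOK (map [_] c))
columnsOK-singletons⁺ []           _  = _
columnsOK-singletons⁺ (x ∷ [])     _  = _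
columnsOK-singletons⁺ (x ∷ y ∷ c) si =
  ∧⁺ (∧⁺ {x <ᵇ y} (proj₁ (∧⁻ {x <ᵇ y} si)) _) (columnsOK-singletons⁺ (y ∷ c) (proj₂ (∧⁻ {x <ᵇ y} si)))

columnsOK-singletons⁻ : ∀ c → T (columnsOK (map [_] c)) → T (strictlyIncreasing c)
columnsOK-singletons⁻ []           _  = _
columnsOK-singletons⁻ (x ∷ [])     _  = _
columnsOK-singletons⁻ (x ∷ y ∷ c) ok =
  ∧⁺ (proj₁ (∧⁻ {x <ᵇ y} (proj₁ (∧⁻ {(x <ᵇ y) ∧ true} ok))))
     (columnsOK-singletons⁻ (y ∷ c) (proj₂ (∧⁻ {(x <ᵇ y) ∧ true} ok)))

allᵇ-singletons : ∀ c → T (allᵇ strictlyIncreasing (map [_] c))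
allᵇ-singletons []      = _
allᵇ-singletons (x ∷ c) = allᵇ-singletons c

column₂⇒c-empty : ∀ r₂ c → T (belowOK r₂ (take 1 c)) → r₂ ≡ [] → c ≡ []
column₂⇒c-empty [] []      _  _ = refl
column₂⇒c-empty [] (_ ∷ _) () _

occurrences-tableau : ∀ j r₁ r₂ c → (r₂ ≡ [] → c ≡ []) →
  occurrences j (concat (tableau r₁ r₂ c)) ≡ occurrences j r₁ + occurrences j r₂ + occurrences j c
occurrences-tableau j r₁ r₂ c c-empty = begin
  occurrences j (concat (tableau r₁ r₂ c))
    ≡⟨ cong (occurrences j) (concat-tableau r₁ r₂ c c-empty) ⟩
  occurrences j (r₁ ++ r₂ ++ c)
    ≡⟨ countᵇ-++ (j ≡ᵇ_) r₁ (r₂ ++ c) ⟩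
  occurrences j r₁ + occurrences j (r₂ ++ c)
    ≡⟨ cong (occurrences j r₁ +_) (countᵇ-++ (j ≡ᵇ_) r₂ c) ⟩
  occurrences j r₁ + (occurrences j r₂ + occurrences j c)
    ≡⟨ +-assoc (occurrences j r₁) _ _ ⟨
  occurrences j r₁ + occurrences j r₂ + occurrences j c ∎

module _ {n : ℕ} {r₁ r₂ c : List ℕ} where

  isSYT-tableau⁺ : Partition₃ n r₁ r₂ c → T (belowOK r₁ r₂) → T (belowOK r₂ (take 1 c)) →
                   T (isSYT n (tableau r₁ r₂ c))
  isSYT-tableau⁺ p col₁ col₂ = ∧⁺ each-once (∧⁺ (rows-sorted r₂ sorted₂) (columns r₂ col₁ col₂))
    where
    open Partition₃ p
    each-once : T (allᵇ (λ j → occurrences j (concat (tableau r₁ r₂ c)) ≡ᵇ 1) (range1 n))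
    each-once = allᵇ⁺ (All.tabulate λ {j} j∈ → ≡⇒≡ᵇ _ 1
      (trans (occurrences-tableau j r₁ r₂ c (column₂⇒c-empty r₂ c col₂)) (once (∈-range1⁻ j∈))))
    rows-sorted : ∀ r₂ → T (strictlyIncreasing r₂) → T (allᵇ strictlyIncreasing (tableau r₁ r₂ c))
    rows-sorted []       _  = ∧⁺ sorted₁ _
    rows-sorted (x ∷ r₂) si = ∧⁺ sorted₁ (∧⁺ si (allᵇ-singletons c))
    columns : ∀ r₂ → T (belowOK r₁ r₂) → T (belowOK r₂ (take 1 c)) → T (columnsOK (tableau r₁ r₂ c))
    columns []       _    _    = _
    columns (x ∷ r₂) col₁ col₂ = ∧⁺ col₁ (below-second c col₂ sorted₃)
      where
      below-second : ∀ c → T (belowOK (x ∷ r₂) (take 1 c)) → T (strictlyIncreasing c) →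
                     T (columnsOK ((x ∷ r₂) ∷ map [_] c))
      below-second []      _    _  = _
      below-second (y ∷ c) col₂ si = ∧⁺ col₂ (columnsOK-singletons⁺ (y ∷ c) si)

is21Shape : ℕ → List ℕ → Bool
is21Shape K μ = (part μ 3 ≤ᵇ 1) ∧ ((part μ 1 ∸ part μ 2) ≡ᵇ K)

shapes21 : ℕ → ℕ → List (List ℕ)
shapes21 K n = filter (T? ∘ is21Shape K) (partitions n)

fillings21 : ℕ → ℕ → List Filling
fillings21 K n = concatMap (fillings n) (shapes21 K n)

Unique-fillings21 : ∀ K n → Unique (fillings21 K n)
Unique-fillings21 K n = Unique-concatMap (fillings n) (map length) (λ {μ} t∈ → proj₁ (∈-fillings⁻ n μ t∈))
  (Unique-fillings n) (Unique.filter⁺ (T? ∘ is21Shape K) (Unique-partitions n))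

sum-singletons : ∀ (c : List ℕ) → sum (map length (map [_] c)) ≡ length c
sum-singletons []      = refl
sum-singletons (x ∷ c) = cong suc (sum-singletons c)

nonIncreasing-singletons : ∀ m (c : List ℕ) → 1 ≤ m → T (nonIncreasing (m ∷ map length (map [_] c)))
nonIncreasing-singletons m []      _   = _
nonIncreasing-singletons m (x ∷ c) 1≤m = ∧⁺ (≤⇒≤ᵇ 1≤m) (nonIncreasing-singletons 1 c ≤-refl)

module _ {K n r₁ r₂ c} (1≤K : 1 ≤ K) (rows : TableauRows K n r₁ r₂ c) where
  open TableauRows rows

  1≤|r₁| : 1 ≤ length r₁
  1≤|r₁| = subst (1 ≤_) (sym excess) (≤-trans 1≤K (m≤n+m K (length r₂)))

  |r₁|∈ : length r₁ ∈ range1 n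
  |r₁|∈ = ∈-range1⁺ (1≤|r₁| ,
                     s≤s (subst (length r₁ ≤_) size (≤-trans (m≤m+n (length r₁) _) (m≤m+n _ (length c)))))

  |r₂|≤n : length r₂ ≤ n
  |r₂|≤n = subst (length r₂ ≤_) size (≤-trans (m≤n+m (length r₂) (length r₁)) (m≤m+n _ (length c)))

  1∈range : 1 ∈ range1 n
  1∈range = ∈-range1⁺ (≤-refl , s≤s (≤-trans 1≤|r₁| (≤-pred (proj₂ (∈-range1⁻ |r₁|∈)))))

within⇒∈range1 : ∀ {n r} → All (Within 1 n) r → All (_∈ range1 n) r
within⇒∈range1 = All.map ∈-range1⁺

tableau-entries : ∀ {K n r₁ r₂ c} → TableauRows K n r₁ r₂ c → All (All (_∈ range1 n)) (tableau r₁ r₂ c)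
tableau-entries {r₂ = []}     rows = within⇒∈range1 (TableauRows.within₁ rows) ∷ []
tableau-entries {r₂ = x ∷ r₂} rows = within⇒∈range1 within₁ ∷ within⇒∈range1 within₂
                                     ∷ All.map⁺ (All.map (λ j∈ → ∈-range1⁺ j∈ ∷ []) within₃)
  where open TableauRows rows

tableau-shape∈ : ∀ {K n r₁ r₂ c} → 1 ≤ K → TableauRows K n r₁ r₂ c →
                 map length (tableau r₁ r₂ c) ∈ shapes21 K n
tableau-shape∈ {K} {n} {r₁} {[]} {c} 1≤K rows =
  ∈-filter⁺ (T? ∘ is21Shape K) (∈-partitions⁺ n (|r₁|∈ 1≤K rows ∷ []) _ (trans (sym (+-identityʳ _)) size′))
              (∧⁺ _ (≡⇒≡ᵇ _ K excess))
  where
  open TableauRows rows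
  size′ : length r₁ + 0 + 0 ≡ n
  size′ = subst (λ c → length r₁ + 0 + length c ≡ n) (column₂⇒c-empty [] c column₂ refl) size
tableau-shape∈ {K} {n} {r₁} {x ∷ r₂} {c} 1≤K rows =
  ∈-filter⁺ (T? ∘ is21Shape K)
    (∈-partitions⁺ n parts-range
       (∧⁺ (≤⇒≤ᵇ (subst (suc (length r₂) ≤_) (sym excess) (m≤m+n _ K)))
           (nonIncreasing-singletons (suc (length r₂)) c (s≤s z≤n)))
       (trans (cong (λ s → length r₁ + (suc (length r₂) + s)) (sum-singletons c))
              (trans (sym (+-assoc (length r₁) _ _)) size)))
    (∧⁺ (third-part c) (≡⇒≡ᵇ _ K (trans (cong (_∸ suc (length r₂)) excess) (m+n∸m≡n (suc (length r₂)) K))))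
  where
  open TableauRows rows
  third-part : ∀ (c : List ℕ) → T (part (length r₁ ∷ suc (length r₂) ∷ map length (map [_] c)) 3 ≤ᵇ 1)
  third-part []      = _
  third-part (_ ∷ _) = _
  parts-range : All (_∈ range1 n) (length r₁ ∷ suc (length r₂) ∷ map length (map [_] c))
  parts-range = |r₁|∈ 1≤K rows ∷ ∈-range1⁺ (s≤s z≤n , s≤s (|r₂|≤n 1≤K rows))
              ∷ All.map⁺ (All.map⁺ (All.universal (λ _ → 1∈range 1≤K rows) c))

tableau∈fillings21 : ∀ {K n r₁ r₂ c} → 1 ≤ K → TableauRows K n r₁ r₂ c → tableau r₁ r₂ c ∈ fillings21 K n
tableau∈fillings21 {n = n} 1≤K rows =
  ∈-concatMap⁺ (fillings n) (lose (tableau-shape∈ 1≤K rows) (∈-fillings⁺ n (tableau-entries rows)))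

rows-sorted⁻ : ∀ r₁ r₂ c → T (allᵇ strictlyIncreasing (tableau r₁ r₂ c)) →
               T (strictlyIncreasing r₁) × T (strictlyIncreasing r₂)
rows-sorted⁻ r₁ []       c si = proj₁ (∧⁻ si) , _
rows-sorted⁻ r₁ (x ∷ r₂) c si = proj₁ (∧⁻ si) , proj₁ (∧⁻ (proj₂ (∧⁻ {strictlyIncreasing r₁} si)))

columns⁻ : ∀ r₁ r₂ c → (r₂ ≡ [] → c ≡ []) → T (columnsOK (tableau r₁ r₂ c)) →
           T (belowOK r₁ r₂) × T (belowOK r₂ (take 1 c)) × T (strictlyIncreasing c)
columns⁻ r₁ []       c c-empty _ rewrite c-empty refl = _ , _ , _
columns⁻ r₁ (x ∷ r₂) c _ ok = proj₁ (∧⁻ ok) , below-second c (proj₂ (∧⁻ {belowOK r₁ (x ∷ r₂)} ok))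
  where
  below-second : ∀ c → T (columnsOK ((x ∷ r₂) ∷ map [_] c)) →
                 T (belowOK (x ∷ r₂) (take 1 c)) × T (strictlyIncreasing c)
  below-second []      _  = _ , _
  below-second (y ∷ c) ok =
    proj₁ (∧⁻ ok) , columnsOK-singletons⁻ (y ∷ c) (proj₂ (∧⁻ {belowOK (x ∷ r₂) [ y ]} ok))

nonIncreasing-tail : ∀ x xs → T (nonIncreasing (x ∷ xs)) → T (nonIncreasing xs)
nonIncreasing-tail x []       _  = _
nonIncreasing-tail x (y ∷ xs) ni = proj₂ (∧⁻ {y ≤ᵇ x} ni)

singletons : ∀ (rows : List (List ℕ)) → All (1 ≤_) (map length rows) → T (nonIncreasing (map length rows)) →
             T (part (map length rows) 1 ≤ᵇ 1) → ∃[ c ] rows ≡ map [_] c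
singletons []                   _           _  _  = [] , refl
singletons ([] ∷ rows)          (() ∷ _)   _  _
singletons ((x ∷ y ∷ r) ∷ rows) _           _  ()
singletons ((x ∷ []) ∷ rows)    (_ ∷ 1≤rows) ni _
  with singletons rows 1≤rows (nonIncreasing-tail 1 (map length rows) ni) (first-part rows ni)
  where
  first-part : ∀ rows → T (nonIncreasing (1 ∷ map length rows)) → T (part (map length rows) 1 ≤ᵇ 1)
  first-part []         _  = _
  first-part (r ∷ rows) ni = proj₁ (∧⁻ ni)
... | c , refl = x ∷ c , refl

record Decomposition (K n : ℕ) (t : Filling) : Set where
  field
    r₁ r₂ c : List ℕ
    t≡      : t ≡ tableau r₁ r₂ c
    c-empty : r₂ ≡ [] → c ≡ []
    within₁ : All (Within 1 n) r₁
    within₂ : All (Within 1 n) r₂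
    within₃ : All (Within 1 n) c
    size    : length r₁ + length r₂ + length c ≡ n
    excess  : length r₁ ≡ length r₂ + K

decompose : ∀ {K n} t → 1 ≤ K → All (All (_∈ range1 n)) t → All (_∈ range1 n) (map length t) →
            T (nonIncreasing (map length t)) → sum (map length t) ≡ n → T (is21Shape K (map length t)) →
            Decomposition K n t
decompose [] 1≤K _ _ _ _ sh = ⊥-elim (<⇒≢ 1≤K (≡ᵇ⇒≡ 0 _ (proj₂ (∧⁻ sh))))
decompose (r₁ ∷ []) 1≤K (e₁ ∷ []) _ _ Σ sh = record
  { r₁ = r₁ ; r₂ = [] ; c = [] ; t≡ = refl ; c-empty = λ _ → refl
  ; within₁ = All.map ∈-range1⁻ e₁ ; within₂ = [] ; within₃ = []
  ; size = trans (+-identityʳ _) Σ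
  ; excess = ≡ᵇ⇒≡ (length r₁) _ (proj₂ (∧⁻ sh)) }
decompose (r₁ ∷ [] ∷ rows) 1≤K _ (_ ∷ 0∈ ∷ _) _ _ _ with () ← proj₁ (∈-range1⁻ 0∈)
decompose {K} {n} (r₁ ∷ (x ∷ r₂) ∷ rows) 1≤K (e₁ ∷ e₂ ∷ es) (_ ∷ _ ∷ parts) ni Σ sh
  with singletons rows (All.map (proj₁ ∘ ∈-range1⁻) parts)
                  (nonIncreasing-tail (suc (length r₂)) (map length rows)
                     (nonIncreasing-tail (length r₁) (suc (length r₂) ∷ map length rows) ni)) (proj₁ (∧⁻ sh))
... | c , refl = record
  { r₁ = r₁ ; r₂ = x ∷ r₂ ; c = c ; t≡ = refl ; c-empty = λ ()
  ; within₁ = All.map ∈-range1⁻ e₁ ; within₂ = All.map ∈-range1⁻ e₂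
  ; within₃ = column (All.map⁻ es)
  ; size = trans (+-assoc (length r₁) _ _)
                 (trans (cong (λ s → length r₁ + (suc (length r₂) + s)) (sym (sum-singletons c))) Σ)
  ; excess = trans (sym (m∸n+n≡m |r₂|≤|r₁|)) (trans (cong (_+ suc (length r₂)) (≡ᵇ⇒≡ _ K (proj₂ (∧⁻ sh))))
                                                    (+-comm K _)) }
  where
  |r₂|≤|r₁| : suc (length r₂) ≤ length r₁
  |r₂|≤|r₁| = ≤ᵇ⇒≤ _ _ (proj₁ (∧⁻ ni))
  column : ∀ {c} → All (λ j → All (_∈ range1 n) [ j ]) c → All (Within 1 n) c
  column = All.map (λ { (j∈ ∷ []) → ∈-range1⁻ j∈ })

∈fillings21⇒decomposition : ∀ {K n t} → 1 ≤ K → t ∈ fillings21 K n → Decomposition K n t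
∈fillings21⇒decomposition {K} {n} {t} 1≤K t∈ with find (∈-concatMap⁻ (fillings n) {xs = shapes21 K n} t∈)
... | μ , μ∈ , t∈μ with ∈-filter⁻ (T? ∘ is21Shape K) {xs = partitions n} μ∈ | ∈-fillings⁻ n μ t∈μ
... | μ∈partitions , sh | refl , entries with ∈-partitions⁻ n μ∈partitions
... | parts , ni , Σ = decompose t 1≤K entries parts ni Σ sh

isSYT⁻ : ∀ n t → T (isSYT n t) →
  T (allᵇ (λ j → occurrences j (concat t) ≡ᵇ 1) (range1 n)) × T (allᵇ strictlyIncreasing t) × T (columnsOK t)
isSYT⁻ n t syt with ∧⁻ {allᵇ (λ j → occurrences j (concat t) ≡ᵇ 1) (range1 n)} syt
... | each-once , rest = each-once , ∧⁻ rest

decomposition⇒rows : ∀ {K n t} (d : Decomposition K n t) → T (isSYT n t) →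
  let open Decomposition d in TableauRows K n r₁ r₂ c
decomposition⇒rows {K} {n} d syt
  with isSYT⁻ n (tableau (Decomposition.r₁ d) (Decomposition.r₂ d) (Decomposition.c d))
              (subst (T ∘ isSYT n) (Decomposition.t≡ d) syt)
... | each-once , sorted , columnsOK = record
  { partition = record
    { within₁ = within₁ ; within₂ = within₂ ; within₃ = within₃
    ; sorted₁ = proj₁ (rows-sorted⁻ r₁ r₂ c sorted) ; sorted₂ = proj₂ (rows-sorted⁻ r₁ r₂ c sorted)
    ; sorted₃ = proj₂ (proj₂ columns)
    ; once    = λ {j} j∈ → trans (sym (occurrences-tableau j r₁ r₂ c c-empty))
                                 (≡ᵇ⇒≡ _ 1 (All.lookup (allᵇ⁻ (range1 n) each-once) (∈-range1⁺ j∈)))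
    ; size    = size }
  ; column₁ = proj₁ columns
  ; column₂ = proj₁ (proj₂ columns)
  ; excess  = excess }
  where
  open Decomposition d
  columns : T (belowOK r₁ r₂) × T (belowOK r₂ (take 1 c)) × T (strictlyIncreasing c)
  columns = columns⁻ r₁ r₂ c c-empty columnsOK

wordOf : ℕ → Filling → List Step
wordOf n []            = encode [] [] n
wordOf n (r₁ ∷ [])     = encode r₁ [] n
wordOf n (r₁ ∷ r₂ ∷ _) = encode r₁ r₂ n

wordOf-tableau : ∀ n r₁ r₂ c → wordOf n (tableau r₁ r₂ c) ≡ encode r₁ r₂ n
wordOf-tableau n r₁ []      c = refl
wordOf-tableau n r₁ (_ ∷ _) c = refl

tableauOf : List Step → Filling
tableauOf w = tableau (positions U w 1) (positions D w 1) (positions F w 1)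

S21≡count-tableauWords : ∀ K n → 1 ≤ K → S21 K n ≡ countᵇ (isTableauWord K 0 false) (stepWords n)
S21≡count-tableauWords K n 1≤K = begin
  S21 K n
    ≡⟨ countᵇ-concatMap (isSYT n) (fillings n) (shapes21 K n) ⟨
  countᵇ (isSYT n) (fillings21 K n)
    ≡⟨ countᵇ-bijection (isSYT n) (isTableauWord K 0 false)
         (Unique-fillings21 K n) (Unique-stepWords Unique-allSteps n) (wordOf n) tableauOf to from ⟩
  countᵇ (isTableauWord K 0 false) (stepWords n) ∎
  where
  Forth : Filling → Set
  Forth t = wordOf n t ∈ stepWords n × T (isTableauWord K 0 false (wordOf n t)) × tableauOf (wordOf n t) ≡ t
  forth : ∀ {r₁ r₂ c} → TableauRows K n r₁ r₂ c → Forth (tableau r₁ r₂ c)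
  forth {r₁} {r₂} {c} rows rewrite wordOf-tableau n r₁ r₂ c with rows⇒tableauWord K rows
  ... | pos₁ , pos₂ , pos₃ , tw =
    subst (λ m → encode r₁ r₂ n ∈ stepWords m) (length-lettersFrom _ 1 n)
          (∈-stepWords⁺ (All.universal ∈-allSteps _)) ,
    tw ,
    trans (cong₂ (λ x y → tableau x y (positions F (encode r₁ r₂ n) 1)) pos₁ pos₂) (cong (tableau r₁ r₂) pos₃)
  to : ∀ {t} → t ∈ fillings21 K n → T (isSYT n t) → Forth t
  to {t} t∈ syt = subst Forth (sym t≡) (forth (decomposition⇒rows d syt))
    where
    d : Decomposition K n t
    d = ∈fillings21⇒decomposition 1≤K t∈
    open Decomposition d
  from : ∀ {w} → w ∈ stepWords n → T (isTableauWord K 0 false w) →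
         tableauOf w ∈ fillings21 K n × T (isSYT n (tableauOf w)) × wordOf n (tableauOf w) ≡ w
  from {w} w∈ tw with proj₁ (∈-stepWords⁻ n w∈)
  ... | refl = tableau∈fillings21 1≤K rows ,
               isSYT-tableau⁺ partition column₁ column₂ ,
               trans (wordOf-tableau (length w) (positions U w 1) (positions D w 1) (positions F w 1))
                     (lettersFrom-positions w 1)
    where
    rows : TableauRows K (length w) (positions U w 1) (positions D w 1) (positions F w 1)
    rows = tableauWord⇒rows K w tw
    open TableauRows rows

count-tableauWords : ∀ K n → countᵇ (isTableauWord K 0 false) (stepWords n) ≡ downFirst K n 0
count-tableauWords K n =
  trans (countᵇ≡sum-𝟙 (isTableauWord K 0 false) (stepWords n)) (count-isTableauWord K n 0)

S21-step : ∀ K n → 1 ≤ K → K ≤ n → S21 K (suc n) + S21 K n ≡ paths n K 0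
S21-step K n 1≤K K≤n = begin
  S21 K (suc n) + S21 K n
    ≡⟨ cong₂ _+_ (trans (S21≡count-tableauWords K (suc n) 1≤K) (count-tableauWords K (suc n)))
                 (trans (S21≡count-tableauWords K n 1≤K) (count-tableauWords K n)) ⟩
  downFirst K (suc n) 0 + downFirst K n 0
    ≡⟨ downFirst-step K n ⟩
  paths n 0 K + 𝟙 (suc n ≡ᵇ K)
    ≡⟨ cong₂ _+_ (paths-sym n 0 K) (cong 𝟙 (≡ᵇ-false (≢-sym (<⇒≢ (s≤s K≤n))))) ⟩
  paths n K 0 + 0
    ≡⟨ +-identityʳ _ ⟩
  paths n K 0 ∎

S21-HM-step : ∀ t m → t + suc t ≤ suc m →
  S21 (t + suc t) (suc (suc m)) + S21 (t + suc t) (suc m) + HM (suc m) (suc t) ≡ HM (suc (suc m)) (suc t)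
S21-HM-step t m K≤ = begin
  S21 K (suc (suc m)) + S21 K (suc m) + HM (suc m) (suc t)
    ≡⟨ cong (_+ HM (suc m) (suc t)) (S21-step K (suc m) (≤-trans (s≤s z≤n) (m≤n+m (suc t) t)) K≤) ⟩
  paths (suc m) K 0 + HM (suc m) (suc t)
    ≡⟨ +-comm (paths (suc m) K 0) _ ⟩
  HM (suc m) (suc t) + paths (suc m) K 0
    ≡⟨ Humps.HM-step t m ⟨
  HM (suc (suc m)) (suc t) ∎
  where
  K : ℕ
  K = t + suc t

2[1+t]∸1≡t+[1+t] : ∀ t → 2 * suc t ∸ 1 ≡ t + suc t
2[1+t]∸1≡t+[1+t] t = cong (λ x → t + suc x) (+-identityʳ t)

corollary3p4 : (n k : ℕ) → 1 ≤ k → k ≤ n / 2 →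
    S21 (2 * k ∸ 1) (n + 1) + S21 (2 * k ∸ 1) n + HM n k ≡ HM (n + 1) k
corollary3p4 n (suc t) _ k≤n/2 rewrite 2[1+t]∸1≡t+[1+t] t | +-comm n 1 = by-cases n 2k≤n
  where
  2k≤n : 2 * suc t ≤ n
  2k≤n = ≤-trans (*-monoʳ-≤ 2 k≤n/2) (subst (_≤ n) (*-comm (n / 2) 2) (m/n*n≤m n 2))
  by-cases : ∀ n → 2 * suc t ≤ n →
    S21 (t + suc t) (suc n) + S21 (t + suc t) n + HM n (suc t) ≡ HM (suc n) (suc t)
  by-cases (suc m) (s≤s 2k-1≤m) =
    S21-HM-step t m (≤-trans (subst (_≤ m) (2[1+t]∸1≡t+[1+t] t) 2k-1≤m) (n≤1+n m))
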